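{- Let $K(v)$ be a complete $t$-partite graph in which each part contains at least three vertices, and let $E$ be a set of edges of $K(v)$ (which is deleted from $K(v)$). Let $(d_1, \ldots, d_k)$ be the sequence of degrees of the vertices of the graph $\langle E\rangle$. Then $$\mu_2 + \xi_2 + 3\xi_3 = \sum_{i=1}^k \binom{d_i}{2} \leq \binom{|E|}{2}.$$
   Context: All graphs are finite and simple. For a sequence $v=(v_1,\dots,v_t)$ of positive integers, $K(v)$ is the complete $t$-partite graph with parts $V_1,\dots,V_t$, $|V_i|=v_i$. Let $E$ be a set of edges of $K(v)$, and let $\langle E\rangle$ denote the subgraph of $K(v)$ consisting of the edges in $E$ and their endpoints. An $E$-subgraph is a subgraph $G_1$ of $K(v)$ which is a complete multipartite graph (with at least two nonempty parts) such that every part of $G_1$ is contained in some part of $K(v)$ and every edge of $G_1$ belongs to $E$. A garland is a nonempty set of pairwise vertex-disjoint $E$-subgraphs; its cardinality is the number of $E$-subgraphs in it, and its edge aggregate is the union of their edge sets. A garland destroys a part $V_i$ if every vertex of $V_i$ lies in some $E$-subgraph of the garland. A garland of cardinality $p$ is interesting if it destroys exactly $p-1$ parts of $K(v)$. $\mu_2$ is the number of interesting garlands whose edge aggregate contains exactly $2$ edges. A $\Xi_2$-subgraph is the subgraph formed by two edges $e_1,e_2\in E$ which, together with a third edge not in $E$, form a triangle of $K(v)$ (i.e. a triangle of $K(v)$ containing exactly two edges of $E$); $\xi_2$ is the number of $\Xi_2$-subgraphs. $\xi_3$ is the number of triangles in $\langle E\rangle$. -}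

module Defs where

open import Data.Bool using (Bool; true; false; _∧_; _∨_; not; if_then_else_)
open import Data.Nat using (ℕ; zero; suc; _+_; _*_; _≤ᵇ_; _<ᵇ_; _≡ᵇ_)
open import Data.Nat.Combinatorics using (_C_)
open import Data.Fin using (Fin; toℕ)
open import Data.Maybe using (Maybe; just; nothing)
open import Data.Product using (_×_; _,_)
open import Data.List using (List; []; _∷_; map; concatMap; allFin; cartesianProduct)
open import Data.Bool.ListAction using (all; any)
open import Data.Nat.ListAction using (sum)
open import Data.Vec using (Vec; lookup) renaming ([] to []ᵥ; _∷_ to _∷ᵥ_)

-- The complete t-partite graph K(v) is represented by its vertex set
-- Fin n together with a map  part : Fin n → Fin t  sending a vertex to
-- the index of its part; V_i = { x | part x ≡ i }, so v_i = partSize part i.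
-- Two vertices are adjacent in K(v) iff they lie in different parts.
-- A set E of edges of K(v) is a symmetric Bool-valued relation
-- E : Fin n → Fin n → Bool all of whose pairs lie in different parts
-- (these hypotheses are stated in the theorem).

_=ꟳ_ : ∀ {n} → Fin n → Fin n → Bool
a =ꟳ b = toℕ a ≡ᵇ toℕ b

_<ꟳ_ : ∀ {n} → Fin n → Fin n → Bool
a <ꟳ b = toℕ a <ᵇ toℕ b

_≤ꟳ_ : ∀ {n} → Fin n → Fin n → Bool
a ≤ꟳ b = toℕ a ≤ᵇ toℕ b

count : ∀ {A : Set} → (A → Bool) → List A → ℕ
count p []       = 0
count p (x ∷ xs) = if p x then suc (count p xs) else count p xs

select : ∀ {A : Set} → (A → Bool) → List A → List A
select p []       = []
select p (x ∷ xs) = if p x then x ∷ select p xs else select p xs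

partSize : ∀ {n t} → (Fin n → Fin t) → Fin t → ℕ
partSize {n} part i = count (λ x → part x =ꟳ i) (allFin n)

deg : ∀ {n} → (Fin n → Fin n → Bool) → Fin n → ℕ
deg {n} E x = count (E x) (allFin n)

verticesE : ∀ {n} → (Fin n → Fin n → Bool) → List (Fin n)
verticesE {n} E = select (λ x → any (E x) (allFin n)) (allFin n)

sumDegC2 : ∀ {n} → (Fin n → Fin n → Bool) → ℕ
sumDegC2 E = sum (map (λ x → deg E x C 2) (verticesE E))

edgeCount : ∀ {n} → (Fin n → Fin n → Bool) → ℕ
edgeCount {n} E =
  sum (map (λ x → count (λ y → (x <ꟳ y) ∧ E x y) (allFin n)) (allFin n))

ξ₃ : ∀ {n} → (Fin n → Fin n → Bool) → ℕ
ξ₃ {n} E =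
  sum (map (λ x → sum (map (λ y →
    count (λ z → (x <ꟳ y) ∧ (y <ꟳ z) ∧ E x y ∧ E y z ∧ E x z) (allFin n))
    (allFin n))) (allFin n))

ξ₂ : ∀ {n t} → (Fin n → Fin t) → (Fin n → Fin n → Bool) → ℕ
ξ₂ {n} part E =
  sum (map (λ b → sum (map (λ a →
    count (λ c → (a <ꟳ c) ∧ E a b ∧ E b c
                 ∧ not (part a =ꟳ part c) ∧ not (E a c)) (allFin n))
    (allFin n))) (allFin n))

-- A garland (set of pairwise vertex-disjoint E-subgraphs) is encoded
-- canonically by a labelling  h : Vec (Maybe (Fin n × Fin n)) n :
--   h x = nothing      iff x lies in no E-subgraph of the garland;
--   h x = just (s , m) iff x lies in the E-subgraph whose least vertex
--                      is s, and in the part of that E-subgraph whose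
--                      least vertex is m.
-- The E-subgraph with label s is the complete multipartite graph whose
-- parts are the classes { x | h x ≡ just (s , m) }.

Labelling : ℕ → Set
Labelling n = Vec (Maybe (Fin n × Fin n)) n

_=ᴸ_ : ∀ {n} → Maybe (Fin n × Fin n) → Maybe (Fin n × Fin n) → Bool
nothing      =ᴸ nothing        = true
just (s , m) =ᴸ just (s' , m') = (s =ꟳ s') ∧ (m =ꟳ m')
_            =ᴸ _              = false

inSub : ∀ {n} → Labelling n → Fin n → Fin n → Bool
inSub h s x with lookup h x
... | nothing       = false
... | just (s' , _) = s' =ꟳ s

edgeOf : ∀ {n} → Labelling n → Fin n → Fin n → Bool
edgeOf h x y with lookup h x | lookup h y
... | just (s , m) | just (s' , m') = (s =ꟳ s') ∧ not (m =ꟳ m')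
... | _            | _              = false

canonical : ∀ {n} → Labelling n → Bool
canonical {n} h = all ok (allFin n)
  where
  ok : Fin n → Bool
  ok x with lookup h x
  ... | nothing      = true
  ... | just (s , m) = (s ≤ꟳ x) ∧ (m ≤ꟳ x)
                       ∧ (lookup h m =ᴸ just (s , m)) ∧ inSub h s s

-- every labelled x: its E-subgraph part lies inside a part of K(v),
-- its E-subgraph has at least two nonempty parts, and all edges of its
-- E-subgraph belong to E
isGarland : ∀ {n t} → (Fin n → Fin t) → (Fin n → Fin n → Bool)
          → Labelling n → Bool
isGarland {n} part E h =
  canonical h
  ∧ any (λ x → not (lookup h x =ᴸ nothing)) (allFin n)
  ∧ all ok (allFin n)
  where
  ok : Fin n → Bool
  ok x with lookup h x
  ... | nothing      = true
  ... | just (s , m) =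
        (part x =ꟳ part m)
        ∧ any (λ y → edgeOf h x y) (allFin n)
        ∧ all (λ y → not (edgeOf h x y) ∨ E x y) (allFin n)

cardinality : ∀ {n} → Labelling n → ℕ
cardinality {n} h = count (λ x → inSub h x x) (allFin n)

aggregateSize : ∀ {n} → Labelling n → ℕ
aggregateSize {n} h =
  sum (map (λ x → count (λ y → (x <ꟳ y) ∧ edgeOf h x y) (allFin n)) (allFin n))

destroys : ∀ {n t} → (Fin n → Fin t) → Labelling n → Fin t → Bool
destroys {n} part h i =
  all (λ x → not (part x =ꟳ i) ∨ not (lookup h x =ᴸ nothing)) (allFin n)

interesting : ∀ {n t} → (Fin n → Fin t) → Labelling n → Bool
interesting {n} {t} part h =
  suc (count (destroys part h) (allFin t)) ≡ᵇ cardinality h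

allVecs : ∀ {A : Set} → List A → (k : ℕ) → List (Vec A k)
allVecs xs zero    = []ᵥ ∷ []
allVecs xs (suc k) = concatMap (λ a → map (a ∷ᵥ_) (allVecs xs k)) xs

allLabellings : (n : ℕ) → List (Labelling n)
allLabellings n =
  allVecs (nothing ∷ map just (cartesianProduct (allFin n) (allFin n))) n

μ₂ : ∀ {n t} → (Fin n → Fin t) → (Fin n → Fin n → Bool) → ℕ
μ₂ {n} part E =
  count (λ h → isGarland part E h ∧ interesting part h
               ∧ (aggregateSize h ≡ᵇ 2)) (allLabellings n)

module Submission where

-- Both sides of the identity count cherries: triples (b; a, c) with a < c
-- and ab, bc ∈ E.  A vertex of degree d centres (d choose 2) cherries, so
-- Σ (dᵢ choose 2) is the number of cherries, and each cherry is of exactly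
-- one of three kinds:
--  * a, c in one part of K(v): these correspond bijectively to the
--    interesting two-edge garlands (one E-subgraph with classes {a, c}, {b};
--    parts of size ≥ 3 guarantee that no part is destroyed), giving μ₂;
--  * ac ∈ E: every triangle is obtained from each of its three centres, 3ξ₃;
--  * a, c in different parts and ac ∉ E: the Ξ₂-subgraphs, ξ₂.
-- For the inequality, (b; a, c) ↦ ({a, b}, {b, c}) injects the ordered
-- cherries (twice as many) into the 2·(|E| choose 2) ordered pairs of edges.

open import Defs
open import Data.Bool using (Bool; true; false; _∧_; _∨_; not; if_then_else_; T)
import Data.Bool.Properties as Boolₚ
open import Data.Bool.ListAction using (all; any)
open import Data.Nat using (ℕ; zero; suc; _+_; _*_; _≤_; _<_; z≤n; s≤s; _<ᵇ_; _≤ᵇ_; _≡ᵇ_)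
open import Data.Nat.Properties
open import Data.Nat.Combinatorics using (_C_; nC1≡n; nCk+nC[k+1]≡[n+1]C[k+1])
open import Data.Nat.ListAction using (sum)
open import Data.Nat.Tactic.RingSolver using (solve-∀)
open import Data.Fin using (Fin; zero; suc; toℕ)
import Data.Fin.Properties as Finₚ
open import Data.Maybe using (Maybe; just; nothing)
import Data.Maybe.Properties as Maybeₚ
open import Data.Vec using (Vec; lookup; tabulate) renaming ([] to []ᵥ; _∷_ to _∷ᵥ_)
import Data.Vec.Properties as Vecₚ
open import Data.List using (List; []; _∷_; map; concatMap; _++_; cartesianProduct; allFin)
import Data.List as List
open import Data.List.Membership.Propositional.Properties using (∈-allFin)
import Data.List.Relation.Unary.All as All
import Data.List.Relation.Unary.Any as Any
open import Data.List.Relation.Unary.All.Properties using (all⁺; all⁻)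
open import Data.List.Relation.Unary.Any.Properties using (any⁺; any⁻)
open import Data.Product using (Σ; _×_; _,_; proj₁; proj₂)
import Data.Product.Properties as Productₚ
open import Data.Sum using (_⊎_; inj₁; inj₂)
import Data.Sum as Sum
open import Data.Empty using (⊥; ⊥-elim)
open import Data.Unit using (tt)
open import Function using (_∘_; _∋_)
open import Relation.Nullary using (Dec; yes; no; does; ¬_)
open import Relation.Binary using (tri<; tri≈; tri>)
open import Relation.Binary.Definitions using (DecidableEquality)
open import Relation.Binary.PropositionalEquality

𝟙 : Bool → ℕ
𝟙 true  = 1
𝟙 false = 0

∑ : ∀ {A : Set} → List A → (A → ℕ) → ℕ
∑ []       f = 0
∑ (x ∷ xs) f = f x + ∑ xs f

module _ {A : Set} where

  count≡∑ : ∀ (p : A → Bool) L → count p L ≡ ∑ L (𝟙 ∘ p)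
  count≡∑ p []      = refl
  count≡∑ p (x ∷ L) with p x
  ... | true  = cong suc (count≡∑ p L)
  ... | false = count≡∑ p L

  sum-map≡∑ : ∀ (f : A → ℕ) L → sum (map f L) ≡ ∑ L f
  sum-map≡∑ f []      = refl
  sum-map≡∑ f (x ∷ L) = cong (f x +_) (sum-map≡∑ f L)

  ∑-cong : ∀ {f g : A → ℕ} L → (∀ x → f x ≡ g x) → ∑ L f ≡ ∑ L g
  ∑-cong []      e = refl
  ∑-cong (x ∷ L) e = cong₂ _+_ (e x) (∑-cong L e)

  ∑-+ : ∀ (f g : A → ℕ) L → ∑ L (λ x → f x + g x) ≡ ∑ L f + ∑ L g
  ∑-+ f g []      = refl
  ∑-+ f g (x ∷ L) = trans (cong (f x + g x +_) (∑-+ f g L)) (interchange (f x) (g x) (∑ L f) (∑ L g))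
    where
    interchange : ∀ a b c d → a + b + (c + d) ≡ a + c + (b + d)
    interchange = solve-∀

  ∑-*ˡ : ∀ k (f : A → ℕ) L → ∑ L (λ x → k * f x) ≡ k * ∑ L f
  ∑-*ˡ k f []      = sym (*-zeroʳ k)
  ∑-*ˡ k f (x ∷ L) = trans (cong (k * f x +_) (∑-*ˡ k f L)) (sym (*-distribˡ-+ k (f x) (∑ L f)))

  ∑-*ʳ : ∀ k (f : A → ℕ) L → ∑ L (λ x → f x * k) ≡ ∑ L f * k
  ∑-*ʳ k f L = trans (∑-cong L (λ x → *-comm (f x) k)) (trans (∑-*ˡ k f L) (*-comm k (∑ L f)))

  ∑-++ : ∀ (f : A → ℕ) L M → ∑ (L ++ M) f ≡ ∑ L f + ∑ M f
  ∑-++ f []      M = refl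
  ∑-++ f (x ∷ L) M = trans (cong (f x +_) (∑-++ f L M)) (sym (+-assoc (f x) (∑ L f) (∑ M f)))

  ∑-mono : ∀ {f g : A → ℕ} L → (∀ x → f x ≤ g x) → ∑ L f ≤ ∑ L g
  ∑-mono []      e = z≤n
  ∑-mono (x ∷ L) e = +-mono-≤ (e x) (∑-mono L e)

  ∑-zero : ∀ {f : A → ℕ} L → (∀ x → f x ≡ 0) → ∑ L f ≡ 0
  ∑-zero []      e = refl
  ∑-zero {f} (x ∷ L) e = trans (cong (_+ ∑ L f) (e x)) (∑-zero L e)

  ∑𝟙-witness : ∀ (p : A → Bool) L → ∑ L (𝟙 ∘ p) ≢ 0 → Σ A (λ u → p u ≡ true)
  ∑𝟙-witness p []      ne = ⊥-elim (ne refl)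
  ∑𝟙-witness p (x ∷ L) ne with p x in px
  ... | true  = x , px
  ... | false = ∑𝟙-witness p L ne

  ∑-select : ∀ (p : A → Bool) (f : A → ℕ) L → (∀ x → p x ≡ false → f x ≡ 0) →
             ∑ (select p L) f ≡ ∑ L f
  ∑-select p f []      e = refl
  ∑-select p f (x ∷ L) e with p x in px
  ... | true  = cong (f x +_) (∑-select p f L e)
  ... | false = trans (∑-select p f L e) (cong (_+ ∑ L f) (sym (e x px)))

∑-map : ∀ {A B : Set} (g : A → B) (f : B → ℕ) L → ∑ (map g L) f ≡ ∑ L (f ∘ g)
∑-map g f []      = refl
∑-map g f (x ∷ L) = cong (f (g x) +_) (∑-map g f L)

∑-swap : ∀ {A B : Set} (f : A → B → ℕ) L M →
         ∑ L (λ x → ∑ M (f x)) ≡ ∑ M (λ y → ∑ L (λ x → f x y))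
∑-swap f []      M = sym (∑-zero M (λ _ → refl))
∑-swap f (x ∷ L) M = trans (cong (∑ M (f x) +_) (∑-swap f L M))
                           (sym (∑-+ (f x) (λ y → ∑ L (λ x → f x y)) M))

∑-product : ∀ {A B : Set} (f : A → ℕ) (g : B → ℕ) L M → ∑ L (λ x → ∑ M (λ y → f x * g y)) ≡ ∑ L f * ∑ M g
∑-product f g L M = trans (∑-cong L (λ x → ∑-*ˡ (f x) g M)) (∑-*ʳ (∑ M g) f L)

∑-concatMap : ∀ {A B : Set} (g : A → List B) (f : B → ℕ) L →
              ∑ (concatMap g L) f ≡ ∑ L (λ x → ∑ (g x) f)
∑-concatMap g f []      = refl
∑-concatMap g f (x ∷ L) = trans (∑-++ f (g x) (concatMap g L)) (cong (∑ (g x) f +_) (∑-concatMap g f L))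

∑-cartesian : ∀ {A B : Set} (f : A × B → ℕ) L M →
              ∑ (cartesianProduct L M) f ≡ ∑ L (λ x → ∑ M (λ y → f (x , y)))
∑-cartesian f []      M = refl
∑-cartesian f (x ∷ L) M = trans (∑-++ f (map (x ,_) M) (cartesianProduct L M))
  (cong₂ _+_ (∑-map (x ,_) f M) (∑-cartesian f L M))

∑-allFin-suc : ∀ n (f : Fin (suc n) → ℕ) → ∑ (allFin (suc n)) f ≡ f zero + ∑ (allFin n) (f ∘ suc)
∑-allFin-suc n f = cong (f zero +_) (∑-tabulate n suc f)
  where
  ∑-tabulate : ∀ {A : Set} m (g : Fin m → A) (f : A → ℕ) → ∑ (List.tabulate g) f ≡ ∑ (allFin m) (f ∘ g)
  ∑-tabulate zero    g f = refl
  ∑-tabulate (suc m) g f = cong (f (g zero) +_)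
    (trans (∑-tabulate m (g ∘ suc) f) (sym (∑-tabulate m suc (f ∘ g))))

𝟙-∧ : ∀ a b → 𝟙 (a ∧ b) ≡ 𝟙 a * 𝟙 b
𝟙-∧ true  b = sym (+-identityʳ (𝟙 b))
𝟙-∧ false b = refl

∧-true₁ : ∀ {x y} → x ∧ y ≡ true → x ≡ true
∧-true₁ {true} _ = refl

∧-true₂ : ∀ {x y} → x ∧ y ≡ true → y ≡ true
∧-true₂ {true} e = e

∧-intro : ∀ {x y} → x ≡ true → y ≡ true → x ∧ y ≡ true
∧-intro refl refl = refl

not-true : ∀ {x} → not x ≡ true → x ≡ false
not-true {false} _ = refl

not-does : ∀ {P : Set} (d : Dec P) → not (does d) ≡ true → ¬ P
not-does (no ¬p) _ = ¬p

𝟙-does-⇔ : ∀ {P Q : Set} (d : Dec P) (e : Dec Q) → (P → Q) → (Q → P) → 𝟙 (does d) ≡ 𝟙 (does e)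
𝟙-does-⇔ (yes p) (yes q) f g = refl
𝟙-does-⇔ (yes p) (no ¬q) f g = ⊥-elim (¬q (f p))
𝟙-does-⇔ (no ¬p) (yes q) f g = ⊥-elim (¬p (g q))
𝟙-does-⇔ (no ¬p) (no ¬q) f g = refl

𝟙-does-× : ∀ {P Q R : Set} (d : Dec R) (d₁ : Dec P) (d₂ : Dec Q) →
           (R → P × Q) → (P → Q → R) → 𝟙 (does d) ≡ 𝟙 (does d₁) * 𝟙 (does d₂)
𝟙-does-× (yes r) (yes p) (yes q) f g = refl
𝟙-does-× (yes r) (yes p) (no ¬q) f g = ⊥-elim (¬q (proj₂ (f r)))
𝟙-does-× (yes r) (no ¬p) d₂      f g = ⊥-elim (¬p (proj₁ (f r)))
𝟙-does-× (no ¬r) (yes p) (yes q) f g = ⊥-elim (¬r (g p q))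
𝟙-does-× (no ¬r) (yes p) (no ¬q) f g = refl
𝟙-does-× (no ¬r) (no ¬p) d₂      f g = refl

module Listings {A : Set} (_≟_ : DecidableEquality A) where

  _≐_ : A → A → ℕ
  y ≐ x = 𝟙 (does (y ≟ x))

  ≐-refl : ∀ x → x ≐ x ≡ 1
  ≐-refl x with x ≟ x
  ... | yes _ = refl
  ... | no ne = ⊥-elim (ne refl)

  ≐-≢ : ∀ {x y} → x ≢ y → x ≐ y ≡ 0
  ≐-≢ {x} {y} ne with x ≟ y
  ... | yes e = ⊥-elim (ne e)
  ... | no _  = refl

  record Listing (L : List A) : Set where
    constructor listing
    field occurs-once : ∀ x → ∑ L (_≐ x) ≡ 1
  open Listing public

  module _ {L : List A} (lst : Listing L) where

    ∑-sift : ∀ x (f : A → ℕ) → ∑ L (λ y → (y ≐ x) * f y) ≡ f x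
    ∑-sift x f = begin
      ∑ L (λ y → (y ≐ x) * f y) ≡⟨ ∑-cong L at-x ⟩
      ∑ L (λ y → (y ≐ x) * f x) ≡⟨ ∑-*ʳ (f x) (_≐ x) L ⟩
      ∑ L (_≐ x) * f x          ≡⟨ cong (_* f x) (occurs-once lst x) ⟩
      1 * f x                   ≡⟨ *-identityˡ (f x) ⟩
      f x                       ∎
      where
      open ≡-Reasoning
      at-x : ∀ y → (y ≐ x) * f y ≡ (y ≐ x) * f x
      at-x y with y ≟ x
      ... | yes refl = refl
      ... | no _     = refl

    term≤∑ : ∀ x (f : A → ℕ) → f x ≤ ∑ L f
    term≤∑ x f = subst (_≤ ∑ L f) (∑-sift x f) (∑-mono L drop-others)
      where
      drop-others : ∀ y → (y ≐ x) * f y ≤ f y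
      drop-others y with y ≟ x
      ... | yes _ = ≤-reflexive (+-identityʳ (f y))
      ... | no _  = z≤n

    ∑𝟙≡0⇒false : (p : A → Bool) → ∑ L (𝟙 ∘ p) ≡ 0 → ∀ w → p w ≡ false
    ∑𝟙≡0⇒false p e w with p w in pw
    ... | false = refl
    ... | true  = ⊥-elim (1+n≰n {0} (subst (1 ≤_) e
                  (subst (λ b → 𝟙 b ≤ ∑ L (𝟙 ∘ p)) pw (term≤∑ w (𝟙 ∘ p)))))

    ∑𝟙-remove : (p : A → Bool) → ∀ u → p u ≡ true →
                ∑ L (𝟙 ∘ p) ≡ suc (∑ L (λ y → 𝟙 (p y ∧ not (does (y ≟ u)))))
    ∑𝟙-remove p u pu = begin
      ∑ L (𝟙 ∘ p)                              ≡⟨ ∑-cong L split ⟩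
      ∑ L (λ y → (y ≐ u) * 𝟙 (p y) + rest y)   ≡⟨ ∑-+ (λ y → (y ≐ u) * 𝟙 (p y)) rest L ⟩
      ∑ L (λ y → (y ≐ u) * 𝟙 (p y)) + ∑ L rest ≡⟨ cong (_+ ∑ L rest) (∑-sift u (𝟙 ∘ p)) ⟩
      𝟙 (p u) + ∑ L rest                        ≡⟨ cong (λ b → 𝟙 b + ∑ L rest) pu ⟩
      suc (∑ L rest)                            ∎
      where
      open ≡-Reasoning
      rest : A → ℕ
      rest y = 𝟙 (p y ∧ not (does (y ≟ u)))
      split : ∀ y → 𝟙 (p y) ≡ (y ≐ u) * 𝟙 (p y) + rest y
      split y with y ≟ u | p y
      ... | yes _ | true  = refl
      ... | yes _ | false = refl
      ... | no _  | true  = refl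
      ... | no _  | false = refl

    ∑𝟙≥2 : (p : A → Bool) → ∀ u v → p u ≡ true → p v ≡ true → u ≢ v → 2 ≤ ∑ L (𝟙 ∘ p)
    ∑𝟙≥2 p u v pu pv u≢v = subst (2 ≤_) (sym (∑𝟙-remove p u pu))
      (s≤s (subst (λ b → 𝟙 b ≤ _) pv-rest (term≤∑ v (λ y → 𝟙 (p y ∧ not (does (y ≟ u)))))))
      where
      pv-rest : p v ∧ not (does (v ≟ u)) ≡ true
      pv-rest with v ≟ u
      ... | yes e = ⊥-elim (u≢v (sym e))
      ... | no _  = trans (cong (_∧ true) pv) refl

    ∑𝟙≡2⇒ : (p : A → Bool) → ∑ L (𝟙 ∘ p) ≡ 2 →
            Σ A λ u → Σ A λ v → p u ≡ true × p v ≡ true × u ≢ v × (∀ w → p w ≡ true → w ≡ u ⊎ w ≡ v)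
    ∑𝟙≡2⇒ p e with ∑𝟙-witness p L (λ z → 1+n≢0 (trans (sym e) z))
    ... | u , pu with ∑𝟙-witness (λ y → p y ∧ not (does (y ≟ u))) L
                        (λ z → 1+n≢0 (trans (sym (suc-injective (trans (sym (∑𝟙-remove p u pu)) e))) z))
    ... | v , qv = u , v , pu , pv , u≢v , only
      where
      q r : A → Bool
      q y = p y ∧ not (does (y ≟ u))
      r y = q y ∧ not (does (y ≟ v))
      count-q : ∑ L (𝟙 ∘ q) ≡ 1
      count-q = suc-injective (trans (sym (∑𝟙-remove p u pu)) e)
      count-r : ∑ L (𝟙 ∘ r) ≡ 0
      count-r = suc-injective (trans (sym (∑𝟙-remove q v qv)) count-q)
      pv : p v ≡ true
      pv = ∧-true₁ qv
      u≢v : u ≢ v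
      u≢v u≡v = not-does (v ≟ u) (∧-true₂ {p v} qv) (sym u≡v)
      only : ∀ w → p w ≡ true → w ≡ u ⊎ w ≡ v
      only w pw with w ≟ u | w ≟ v | ∑𝟙≡0⇒false r count-r w
      ... | yes w≡u | _       | _ = inj₁ w≡u
      ... | no _    | yes w≡v | _ = inj₂ w≡v
      ... | no _    | no _    | rw with () ← trans (sym rw) (cong (λ b → (b ∧ true) ∧ true) pw)

    ∑𝟙≡2⇐ : (p : A → Bool) → ∀ u v → p u ≡ true → p v ≡ true → u ≢ v →
            (∀ w → p w ≡ true → w ≡ u ⊎ w ≡ v) → ∑ L (𝟙 ∘ p) ≡ 2
    ∑𝟙≡2⇐ p u v pu pv u≢v only = trans (∑-cong L as-indicators)
      (trans (∑-+ _ _ L) (cong₂ _+_ (occurs-once lst u) (occurs-once lst v)))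
      where
      as-indicators : ∀ w → 𝟙 (p w) ≡ (w ≐ u) + (w ≐ v)
      as-indicators w with w ≟ u | w ≟ v
      ... | yes refl | yes refl = ⊥-elim (u≢v refl)
      ... | yes refl | no _     = cong 𝟙 pu
      ... | no _     | yes refl = cong 𝟙 pv
      ... | no w≢u   | no w≢v   with p w in pw
      ...   | false = refl
      ...   | true with only w pw
      ...     | inj₁ w≡u = ⊥-elim (w≢u w≡u)
      ...     | inj₂ w≡v = ⊥-elim (w≢v w≡v)

module Transfer {A B : Set} (_≟A_ : DecidableEquality A) (_≟B_ : DecidableEquality B)
                {L : List A} {M : List B}
                (listL : Listings.Listing _≟A_ L) (listM : Listings.Listing _≟B_ M) where
  open Listings _≟A_ using () renaming (_≐_ to _≐ᴬ_; ∑-sift to ∑-siftᴬ; ≐-refl to ≐ᴬ-refl; occurs-once to occurs-onceᴬ)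
  open Listings _≟B_ using () renaming (_≐_ to _≐ᴮ_; ∑-sift to ∑-siftᴮ; occurs-once to occurs-onceᴮ)

  count-bijection : (p : A → Bool) (q : B → Bool) (enc : B → A)
    → (∀ t → q t ≡ true → p (enc t) ≡ true)
    → (∀ a → p a ≡ true → Σ B λ t → q t ≡ true × a ≡ enc t)
    → (∀ t t' → q t ≡ true → q t' ≡ true → enc t ≡ enc t' → t ≡ t')
    → ∑ L (𝟙 ∘ p) ≡ ∑ M (𝟙 ∘ q)
  count-bijection p q enc sound complete injective = begin
    ∑ L (𝟙 ∘ p)                                    ≡⟨ ∑-cong L fibre ⟩
    ∑ L (λ a → ∑ M (λ t → (a ≐ᴬ enc t) * 𝟙 (q t))) ≡⟨ ∑-swap (λ a t → (a ≐ᴬ enc t) * 𝟙 (q t)) L M ⟩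
    ∑ M (λ t → ∑ L (λ a → (a ≐ᴬ enc t) * 𝟙 (q t))) ≡⟨ ∑-cong M (λ t → ∑-siftᴬ listL (enc t) (λ _ → 𝟙 (q t))) ⟩
    ∑ M (𝟙 ∘ q)                                    ∎
    where
    open ≡-Reasoning
    fibre : ∀ a → 𝟙 (p a) ≡ ∑ M (λ t → (a ≐ᴬ enc t) * 𝟙 (q t))
    fibre a with p a in pa
    ... | true with complete a pa
    ...   | t₀ , qt₀ , refl = sym (trans (∑-cong M only-t₀) (∑-siftᴮ listM t₀ (λ _ → 1)))
      where
      only-t₀ : ∀ t → (enc t₀ ≐ᴬ enc t) * 𝟙 (q t) ≡ (t ≐ᴮ t₀) * 1
      only-t₀ t with t ≟B t₀
      ... | yes refl rewrite qt₀ | ≐ᴬ-refl (enc t) = refl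
      ... | no t≢t₀ with q t in qt | enc t₀ ≟A enc t
      ...   | true  | yes e = ⊥-elim (t≢t₀ (injective t t₀ qt qt₀ (sym e)))
      ...   | true  | no _  = refl
      ...   | false | yes _ = refl
      ...   | false | no _  = refl
    fibre a | false = sym (∑-zero M empty)
      where
      empty : ∀ t → (a ≐ᴬ enc t) * 𝟙 (q t) ≡ 0
      empty t with q t in qt | a ≟A enc t
      ... | true  | yes refl with () ← trans (sym pa) (sound t qt)
      ... | true  | no _  = refl
      ... | false | yes _ = refl
      ... | false | no _  = refl

  count-injection : (p : A → Bool) (q : B → Bool) (f : A → B)
    → (∀ a → p a ≡ true → q (f a) ≡ true)
    → (∀ a a' → p a ≡ true → p a' ≡ true → f a ≡ f a' → a ≡ a')
    → ∑ L (𝟙 ∘ p) ≤ ∑ M (𝟙 ∘ q)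
  count-injection p q f maps-to injective = begin
    ∑ L (𝟙 ∘ p)                                   ≡⟨ ∑-cong L (λ a → sym (∑-siftᴮ listM (f a) (λ _ → 𝟙 (p a)))) ⟩
    ∑ L (λ a → ∑ M (λ t → (t ≐ᴮ f a) * 𝟙 (p a)))  ≡⟨ ∑-swap (λ a t → (t ≐ᴮ f a) * 𝟙 (p a)) L M ⟩
    ∑ M (λ t → ∑ L (λ a → (t ≐ᴮ f a) * 𝟙 (p a)))  ≤⟨ ∑-mono M fibre ⟩
    ∑ M (𝟙 ∘ q)                                   ∎
    where
    open ≤-Reasoning
    preimage : B → A → Bool
    preimage t a = p a ∧ does (t ≟B f a)
    as-preimage : ∀ t a → (t ≐ᴮ f a) * 𝟙 (p a) ≡ 𝟙 (preimage t a)
    as-preimage t a with t ≟B f a | p a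
    ... | yes _ | true  = refl
    ... | yes _ | false = refl
    ... | no _  | true  = refl
    ... | no _  | false = refl
    fibre : ∀ t → ∑ L (λ a → (t ≐ᴮ f a) * 𝟙 (p a)) ≤ 𝟙 (q t)
    fibre t rewrite ∑-cong L (as-preimage t) with ∑ L (𝟙 ∘ preimage t) Data.Nat.≟ 0
    ... | yes empty = subst (_≤ 𝟙 (q t)) (sym empty) z≤n
    ... | no nonempty with ∑𝟙-witness (preimage t) L nonempty
    ...   | a₀ , pre-a₀ = ≤-trans (∑-mono L at-most-a₀)
              (≤-reflexive (trans (occurs-onceᴬ listL a₀) (sym qt≡1)))
      where
      pa₀ : p a₀ ≡ true
      pa₀ = ∧-true₁ pre-a₀
      t≡fa₀ : t ≡ f a₀
      t≡fa₀ = does⇒ (t ≟B f a₀) (∧-true₂ {p a₀} pre-a₀)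
        where
        does⇒ : ∀ {P : Set} (d : Dec P) → does d ≡ true → P
        does⇒ (yes x) _ = x
      qt≡1 : 𝟙 (q t) ≡ 1
      qt≡1 = cong 𝟙 (trans (cong q t≡fa₀) (maps-to a₀ pa₀))
      at-most-a₀ : ∀ a → 𝟙 (preimage t a) ≤ 𝟙 (does (a ≟A a₀))
      at-most-a₀ a with p a in pa | t ≟B f a | a ≟A a₀
      ... | false | _      | _     = z≤n
      ... | true  | no _   | _     = z≤n
      ... | true  | yes _  | yes _ = ≤-refl
      ... | true  | yes e  | no ne = ⊥-elim (ne (injective a a₀ pa pa₀ (trans (sym e) t≡fa₀)))

module _ where
  open Listings

  _≟F_ : ∀ {n} → DecidableEquality (Fin n)
  _≟F_ = Finₚ._≟_

  _≟×_ : ∀ {A B : Set} → DecidableEquality A → DecidableEquality B → DecidableEquality (A × B)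
  dA ≟× dB = Productₚ.≡-dec dA dB

  listing-allFin : ∀ n → Listing (_≟F_ {n}) (allFin n)
  listing-allFin zero    = listing (λ ())
  listing-allFin (suc n) = listing once
    where
    once : ∀ x → ∑ (allFin (suc n)) (λ y → 𝟙 (does (y ≟F x))) ≡ 1
    once x rewrite ∑-allFin-suc n (λ y → 𝟙 (does (y ≟F x))) with x
    ... | zero   = cong suc (∑-zero (allFin n) (λ y → ≐-≢ _≟F_ {suc y} {zero} λ ()))
    ... | suc x' = trans (∑-cong (allFin n) (λ y → 𝟙-does-⇔ (suc y ≟F suc x') (y ≟F x')
                                                            Finₚ.suc-injective (cong suc)))
                         (occurs-once (listing-allFin n) x')

  listing-cartesian : ∀ {A B : Set} (dA : DecidableEquality A) (dB : DecidableEquality B) {L M}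
    → Listing dA L → Listing dB M → Listing (dA ≟× dB) (cartesianProduct L M)
  listing-cartesian dA dB {L} {M} listL listM = listing once
    where
    open ≡-Reasoning
    once : ∀ x → ∑ (cartesianProduct L M) (λ y → 𝟙 (does ((dA ≟× dB) y x))) ≡ 1
    once (x₁ , x₂) = begin
      ∑ (cartesianProduct L M) (λ y → 𝟙 (does ((dA ≟× dB) y (x₁ , x₂))))
        ≡⟨ ∑-cartesian _ L M ⟩
      ∑ L (λ y₁ → ∑ M (λ y₂ → 𝟙 (does ((dA ≟× dB) (y₁ , y₂) (x₁ , x₂)))))
        ≡⟨ ∑-cong L (λ y₁ → ∑-cong M (λ y₂ →
             𝟙-does-× ((dA ≟× dB) (y₁ , y₂) (x₁ , x₂)) (dA y₁ x₁) (dB y₂ x₂)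
                      (λ { refl → refl , refl }) (λ { refl refl → refl }))) ⟩
      ∑ L (λ y₁ → ∑ M (λ y₂ → 𝟙 (does (dA y₁ x₁)) * 𝟙 (does (dB y₂ x₂))))
        ≡⟨ ∑-product (λ y₁ → 𝟙 (does (dA y₁ x₁))) (λ y₂ → 𝟙 (does (dB y₂ x₂))) L M ⟩
      ∑ L (λ y₁ → 𝟙 (does (dA y₁ x₁))) * ∑ M (λ y₂ → 𝟙 (does (dB y₂ x₂)))
        ≡⟨ cong₂ _*_ (occurs-once listL x₁) (occurs-once listM x₂) ⟩
      1 ∎

  listing-maybe : ∀ {A : Set} (dA : DecidableEquality A) {L} → Listing dA L
    → Listing (Maybeₚ.≡-dec dA) (nothing ∷ map just L)
  listing-maybe dA {L} listL = listing once
    where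
    once : ∀ x → ∑ (nothing ∷ map just L) (λ y → 𝟙 (does (Maybeₚ.≡-dec dA y x))) ≡ 1
    once nothing  = cong suc (trans (∑-map just _ L) (∑-zero L (λ y → refl)))
    once (just x) = trans (∑-map just _ L)
      (trans (∑-cong L (λ y → 𝟙-does-⇔ (Maybeₚ.≡-dec dA (just y) (just x)) (dA y x)
                                        Maybeₚ.just-injective (cong just)))
             (occurs-once listL x))

  listing-vecs : ∀ {A : Set} (dA : DecidableEquality A) {L} → Listing dA L
    → ∀ k → Listing (Vecₚ.≡-dec {n = k} dA) (allVecs L k)
  listing-vecs dA listL zero    = listing λ { []ᵥ → refl }
  listing-vecs dA {L} listL (suc k) = listing once
    where
    open ≡-Reasoning
    _≟V_ : ∀ {m} → DecidableEquality (Vec _ m)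
    _≟V_ = Vecₚ.≡-dec dA
    once : ∀ x → ∑ (allVecs L (suc k)) (λ y → 𝟙 (does (y ≟V x))) ≡ 1
    once (a ∷ᵥ w) = begin
      ∑ (allVecs L (suc k)) (λ y → 𝟙 (does (y ≟V (a ∷ᵥ w))))
        ≡⟨ ∑-concatMap (λ a' → map (a' ∷ᵥ_) (allVecs L k)) _ L ⟩
      ∑ L (λ a' → ∑ (map (a' ∷ᵥ_) (allVecs L k)) (λ y → 𝟙 (does (y ≟V (a ∷ᵥ w)))))
        ≡⟨ ∑-cong L (λ a' → ∑-map (a' ∷ᵥ_) _ (allVecs L k)) ⟩
      ∑ L (λ a' → ∑ (allVecs L k) (λ v → 𝟙 (does ((a' ∷ᵥ v) ≟V (a ∷ᵥ w)))))
        ≡⟨ ∑-cong L (λ a' → ∑-cong (allVecs L k) (λ v →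
             𝟙-does-× ((a' ∷ᵥ v) ≟V (a ∷ᵥ w)) (dA a' a) (v ≟V w)
                      Vecₚ.∷-injective (λ { refl refl → refl }))) ⟩
      ∑ L (λ a' → ∑ (allVecs L k) (λ v → 𝟙 (does (dA a' a)) * 𝟙 (does (v ≟V w))))
        ≡⟨ ∑-product (λ a' → 𝟙 (does (dA a' a))) (λ v → 𝟙 (does (v ≟V w))) L (allVecs L k) ⟩
      ∑ L (λ a' → 𝟙 (does (dA a' a))) * ∑ (allVecs L k) (λ v → 𝟙 (does (v ≟V w)))
        ≡⟨ cong₂ _*_ (occurs-once listL a) (occurs-once (listing-vecs dA listL k) w) ⟩
      1 ∎

  _≟L_ : ∀ {n} → DecidableEquality (Labelling n)
  _≟L_ = Vecₚ.≡-dec (Maybeₚ.≡-dec (_≟F_ ≟× _≟F_))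

  listing-labellings : ∀ n → Listing (_≟L_ {n}) (allLabellings n)
  listing-labellings n = listing-vecs _
    (listing-maybe _ (listing-cartesian _≟F_ _≟F_ (listing-allFin n) (listing-allFin n))) n

T⇒≡true : ∀ {b} → T b → b ≡ true
T⇒≡true {true} _ = refl

≡true⇒T : ∀ {b} → b ≡ true → T b
≡true⇒T refl = tt

<ᵇ-true : ∀ {x y} → x < y → (x <ᵇ y) ≡ true
<ᵇ-true x<y = T⇒≡true (<⇒<ᵇ x<y)

<ᵇ-false : ∀ {x y} → y ≤ x → (x <ᵇ y) ≡ false
<ᵇ-false {x} {y} y≤x with x <ᵇ y in x<ᵇy
... | false = refl
... | true  = ⊥-elim (<⇒≱ (<ᵇ⇒< x y (≡true⇒T x<ᵇy)) y≤x)

<ᵇ⇒<′ : ∀ {x y} → (x <ᵇ y) ≡ true → x < y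
<ᵇ⇒<′ {x} {y} e = <ᵇ⇒< x y (≡true⇒T e)

≤ᵇ-true : ∀ {x y} → x ≤ y → (x ≤ᵇ y) ≡ true
≤ᵇ-true x≤y = T⇒≡true (≤⇒≤ᵇ x≤y)

≤ᵇ⇒≤′ : ∀ {x y} → (x ≤ᵇ y) ≡ true → x ≤ y
≤ᵇ⇒≤′ {x} {y} e = ≤ᵇ⇒≤ x y (≡true⇒T e)

≡ᵇ-refl : ∀ x → (x ≡ᵇ x) ≡ true
≡ᵇ-refl x = T⇒≡true (≡⇒≡ᵇ x x refl)

≡ᵇ-false : ∀ {x y} → x ≢ y → (x ≡ᵇ y) ≡ false
≡ᵇ-false {x} {y} x≢y with x ≡ᵇ y in x≡ᵇy
... | false = refl
... | true  = ⊥-elim (x≢y (≡ᵇ⇒≡ x y (≡true⇒T x≡ᵇy)))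

module _ {n : ℕ} where

  =ꟳ⇒≡ : {a b : Fin n} → (a =ꟳ b) ≡ true → a ≡ b
  =ꟳ⇒≡ {a} {b} e = Finₚ.toℕ-injective (≡ᵇ⇒≡ (toℕ a) (toℕ b) (≡true⇒T e))

  =ꟳ-refl : (a : Fin n) → (a =ꟳ a) ≡ true
  =ꟳ-refl a = ≡ᵇ-refl (toℕ a)

  =ꟳ-false : {a b : Fin n} → a ≢ b → (a =ꟳ b) ≡ false
  =ꟳ-false a≢b = ≡ᵇ-false (λ e → a≢b (Finₚ.toℕ-injective e))

  =ꟳ-false⇒≢ : {a b : Fin n} → (a =ꟳ b) ≡ false → a ≢ b
  =ꟳ-false⇒≢ {a} e refl with () ← trans (sym (=ꟳ-refl a)) e

order-split : ∀ x y z → y ≢ x → y ≢ z →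
  𝟙 (x <ᵇ z) ≡ 𝟙 ((y <ᵇ x) ∧ (x <ᵇ z)) + 𝟙 ((x <ᵇ y) ∧ (y <ᵇ z)) + 𝟙 ((x <ᵇ z) ∧ (z <ᵇ y))
order-split x y z y≢x y≢z with <-cmp x z
order-split x y z y≢x y≢z | tri< x<z _ _ rewrite <ᵇ-true x<z with <-cmp y x
... | tri< y<x _ _ rewrite <ᵇ-true y<x | <ᵇ-false (<⇒≤ y<x) | <ᵇ-false (<⇒≤ (<-trans y<x x<z)) = refl
... | tri≈ _ y≡x _ = ⊥-elim (y≢x y≡x)
... | tri> _ _ x<y rewrite <ᵇ-false (<⇒≤ x<y) | <ᵇ-true x<y with <-cmp y z
...   | tri< y<z _ _ rewrite <ᵇ-true y<z | <ᵇ-false (<⇒≤ y<z) = refl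
...   | tri≈ _ y≡z _ = ⊥-elim (y≢z y≡z)
...   | tri> _ _ z<y rewrite <ᵇ-false (<⇒≤ z<y) | <ᵇ-true z<y = refl
order-split x y z y≢x y≢z | tri≈ _ refl _ rewrite <ᵇ-false (≤-refl {x}) with <-cmp x y
... | tri< x<y _ _ rewrite <ᵇ-true x<y | <ᵇ-false (<⇒≤ x<y) = refl
... | tri≈ _ x≡y _ = ⊥-elim (y≢z (sym x≡y))
... | tri> _ _ y<x rewrite <ᵇ-false (<⇒≤ y<x) | Boolₚ.∧-zeroʳ (y <ᵇ x) = refl
order-split x y z y≢x y≢z | tri> _ _ z<x rewrite <ᵇ-false (<⇒≤ z<x) | Boolₚ.∧-zeroʳ (y <ᵇ x)
  with x <ᵇ y in x<ᵇy
... | false = refl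
... | true rewrite <ᵇ-false {y} {z} (<⇒≤ (<-trans z<x (<ᵇ⇒<′ {x} {y} x<ᵇy))) = refl

choose2-pairs : ∀ m (P : Fin m → Bool) →
  ∑ (allFin m) (𝟙 ∘ P) C 2 ≡ ∑ (allFin m) (λ a → ∑ (allFin m) (λ c → 𝟙 ((a <ꟳ c) ∧ P a ∧ P c)))
choose2-pairs zero    P = refl
choose2-pairs (suc m) P = begin
  ∑ (allFin (suc m)) (𝟙 ∘ P) C 2
    ≡⟨ cong (_C 2) (∑-allFin-suc m (𝟙 ∘ P)) ⟩
  (𝟙 (P zero) + #rest) C 2
    ≡⟨ split-first ⟩
  ∑ (allFin m) (λ c → 𝟙 (P zero ∧ P (suc c))) + pairs m (P ∘ suc)
    ≡⟨ cong₂ _+_ (sym (∑-allFin-suc m (λ c → 𝟙 ((zero <ꟳ c) ∧ P zero ∧ P c))))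
                 (∑-cong (allFin m) (λ a → sym (∑-allFin-suc m (λ c → 𝟙 ((suc a <ꟳ c) ∧ P (suc a) ∧ P c))))) ⟩
  ∑ (allFin (suc m)) (λ c → 𝟙 ((zero <ꟳ c) ∧ P zero ∧ P c))
    + ∑ (allFin m) (λ a → ∑ (allFin (suc m)) (λ c → 𝟙 ((suc a <ꟳ c) ∧ P (suc a) ∧ P c)))
    ≡⟨ ∑-allFin-suc m (λ a → ∑ (allFin (suc m)) (λ c → 𝟙 ((a <ꟳ c) ∧ P a ∧ P c))) ⟨
  pairs (suc m) P ∎
  where
  open ≡-Reasoning
  pairs : ∀ k → (Fin k → Bool) → ℕ
  pairs k Q = ∑ (allFin k) (λ a → ∑ (allFin k) (λ c → 𝟙 ((a <ꟳ c) ∧ Q a ∧ Q c)))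
  #rest : ℕ
  #rest = ∑ (allFin m) (𝟙 ∘ (P ∘ suc))
  -- Pascal's rule: the pairs containing the first element, plus the others
  split-first : (𝟙 (P zero) + #rest) C 2 ≡ ∑ (allFin m) (λ c → 𝟙 (P zero ∧ P (suc c))) + pairs m (P ∘ suc)
  split-first with P zero
  ... | true  = begin
    suc #rest C 2          ≡⟨ nCk+nC[k+1]≡[n+1]C[k+1] #rest 1 ⟨
    #rest C 1 + #rest C 2  ≡⟨ cong₂ _+_ (nC1≡n #rest) (choose2-pairs m (P ∘ suc)) ⟩
    #rest + pairs m (P ∘ suc) ∎
  ... | false = trans (choose2-pairs m (P ∘ suc))
                      (cong (_+ pairs m (P ∘ suc)) (sym (∑-zero (allFin m) (λ _ → refl))))

-- ordered pairs of distinct elements of an m-set: m² = 2·(m choose 2) + m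
twice-choose2 : ∀ m → 2 * (m C 2) + m ≡ m * m
twice-choose2 zero    = refl
twice-choose2 (suc m) = begin
  2 * (suc m C 2) + suc m        ≡⟨ cong (λ k → 2 * k + suc m) (sym (nCk+nC[k+1]≡[n+1]C[k+1] m 1)) ⟩
  2 * (m C 1 + m C 2) + suc m    ≡⟨ cong (λ k → 2 * (k + m C 2) + suc m) (nC1≡n m) ⟩
  2 * (m + m C 2) + suc m        ≡⟨ regroup m (m C 2) ⟩
  suc m + m + (2 * (m C 2) + m)  ≡⟨ cong (suc m + m +_) (twice-choose2 m) ⟩
  suc m + m + m * m              ≡⟨ square m ⟩
  suc m * suc m                  ∎
  where
  open ≡-Reasoning
  regroup : ∀ m k → 2 * (m + k) + suc m ≡ suc m + m + (2 * k + m)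
  regroup = solve-∀
  square : ∀ m → suc m + m + m * m ≡ suc m * suc m
  square = solve-∀

module _ {A : Set} (_≟_ : DecidableEquality A) {L : List A} (lst : Listings.Listing _≟_ L) where
  open Listings _≟_

  distinct-pairs : (p : A → Bool) →
    ∑ (cartesianProduct L L) (λ { (e , f) → 𝟙 (p e ∧ p f ∧ not (does (e ≟ f))) }) ≡ 2 * (∑ L (𝟙 ∘ p) C 2)
  distinct-pairs p = +-cancelʳ-≡ m _ _ (trans all-pairs (sym (twice-choose2 m)))
    where
    open ≡-Reasoning
    m : ℕ
    m = ∑ L (𝟙 ∘ p)
    distinct : A → A → ℕ
    distinct e f = 𝟙 (p e ∧ p f ∧ not (does (e ≟ f)))
    pair : ∀ e f → 𝟙 (p e) * 𝟙 (p f) ≡ distinct e f + (f ≐ e) * 𝟙 (p f)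
    pair e f with f ≟ e | e ≟ f
    ... | yes refl | yes _ with p e
    ...   | true  = refl
    ...   | false = refl
    pair e f | yes refl | no e≢e = ⊥-elim (e≢e refl)
    pair e f | no f≢f   | yes refl = ⊥-elim (f≢f refl)
    pair e f | no _     | no _ with p e | p f
    ... | true  | true  = refl
    ... | true  | false = refl
    ... | false | _     = refl
    all-pairs : ∑ (cartesianProduct L L) (λ { (e , f) → distinct e f }) + m ≡ m * m
    all-pairs = begin
      ∑ (cartesianProduct L L) (λ { (e , f) → distinct e f }) + m
        ≡⟨ cong₂ _+_ (∑-cartesian _ L L) (sym (∑-cong L (λ e → ∑-sift lst e (𝟙 ∘ p)))) ⟩
      ∑ L (λ e → ∑ L (distinct e)) + ∑ L (λ e → ∑ L (λ f → (f ≐ e) * 𝟙 (p f)))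
        ≡⟨ ∑-+ _ _ L ⟨
      ∑ L (λ e → ∑ L (distinct e) + ∑ L (λ f → (f ≐ e) * 𝟙 (p f)))
        ≡⟨ ∑-cong L (λ e → sym (trans (∑-cong L (pair e)) (∑-+ _ _ L))) ⟩
      ∑ L (λ e → ∑ L (λ f → 𝟙 (p e) * 𝟙 (p f)))
        ≡⟨ ∑-product (𝟙 ∘ p) (𝟙 ∘ p) L L ⟩
      m * m ∎

module _ {n : ℕ} where

  Joins : Fin n → Fin n → Fin n → Fin n → Set
  Joins p q x y = (x ≡ p × y ≡ q) ⊎ (x ≡ q × y ≡ p)

  Joins-flip : ∀ {p q x y} → Joins p q x y → Joins q p x y
  Joins-flip (inj₁ e) = inj₂ e
  Joins-flip (inj₂ e) = inj₁ e

  sort : Fin n → Fin n → Fin n × Fin n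
  sort x y = if x <ꟳ y then (x , y) else (y , x)

  sort-≡ : ∀ {x y x' y'} → sort x y ≡ sort x' y' → Joins x' y' x y
  sort-≡ {x} {y} {x'} {y'} e with x <ꟳ y | x' <ꟳ y' | e
  ... | true  | true  | refl = inj₁ (refl , refl)
  ... | true  | false | refl = inj₂ (refl , refl)
  ... | false | true  | refl = inj₂ (refl , refl)
  ... | false | false | refl = inj₁ (refl , refl)

  sorted≡sort : ∀ {x y p q} → toℕ x < toℕ y → Joins p q x y → (x , y) ≡ sort p q
  sorted≡sort x<y (inj₁ (refl , refl)) rewrite <ᵇ-true x<y = refl
  sorted≡sort x<y (inj₂ (refl , refl)) rewrite <ᵇ-false (<⇒≤ x<y) = refl

  Increasing : (Fin n → Fin n → Bool) → Fin n × Fin n → Bool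
  Increasing R (u , v) = (u <ꟳ v) ∧ R u v

  sort-increasing : ∀ (R : Fin n → Fin n → Bool) → (∀ {x y} → R x y ≡ true → R y x ≡ true) → (∀ {x} → R x x ≡ true → ⊥)
    → ∀ {x y} → R x y ≡ true → Increasing R (sort x y) ≡ true
  sort-increasing R R-sym R-irrefl {x} {y} r with x <ꟳ y in x<y
  ... | true  = ∧-intro x<y r
  ... | false with <-cmp (toℕ x) (toℕ y)
  ...   | tri< lt _ _ with () ← trans (sym (<ᵇ-true lt)) x<y
  ...   | tri≈ _ q _  rewrite Finₚ.toℕ-injective q = ⊥-elim (R-irrefl r)
  ...   | tri> _ _ gt = ∧-intro (<ᵇ-true gt) (R-sym r)

  as-path : ∀ u₁ u₂ v₁ v₂ → ¬ Joins u₁ u₂ v₁ v₂ → (u₁ ≡ v₁ ⊎ u₁ ≡ v₂) ⊎ (u₂ ≡ v₁ ⊎ u₂ ≡ v₂) →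
    Σ (Fin n) λ a → Σ (Fin n) λ b → Σ (Fin n) λ c → a ≢ c
      × (∀ {x y} → Joins u₁ u₂ x y ⊎ Joins v₁ v₂ x y → Joins a b x y ⊎ Joins b c x y)
      × (∀ {x y} → Joins a b x y ⊎ Joins b c x y → Joins u₁ u₂ x y ⊎ Joins v₁ v₂ x y)
  as-path u₁ u₂ .u₁ v₂ distinct (inj₁ (inj₁ refl)) =
    u₂ , u₁ , v₂ , (λ { refl → distinct (inj₁ (refl , refl)) }) , Sum.map₁ Joins-flip , Sum.map₁ Joins-flip
  as-path u₁ u₂ v₁ .u₁ distinct (inj₁ (inj₂ refl)) =
    u₂ , u₁ , v₁ , (λ { refl → distinct (inj₂ (refl , refl)) }) , Sum.map Joins-flip Joins-flip , Sum.map Joins-flip Joins-flip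
  as-path u₁ u₂ .u₂ v₂ distinct (inj₂ (inj₁ refl)) =
    u₁ , u₂ , v₂ , (λ { refl → distinct (inj₂ (refl , refl)) }) , (λ j → j) , (λ j → j)
  as-path u₁ u₂ v₁ .u₂ distinct (inj₂ (inj₂ refl)) =
    u₁ , u₂ , v₁ , (λ { refl → distinct (inj₁ (refl , refl)) }) , Sum.map₂ Joins-flip , Sum.map₂ Joins-flip

module Cherries {n t : ℕ} (part : Fin n → Fin t) (E : Fin n → Fin n → Bool)
  (E-sym : ∀ x y → E x y ≡ E y x) (E-across : ∀ x y → E x y ≡ true → part x ≢ part y) where

  V : List (Fin n)
  V = allFin n

  E⇒≢ : ∀ {x y} → E x y ≡ true → x ≢ y
  E⇒≢ {x} e refl = E-across x x e refl

  E-sym⇒ : ∀ {x y} → E x y ≡ true → E y x ≡ true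
  E-sym⇒ {x} {y} e = trans (E-sym y x) e

  E-irrefl : ∀ {x} → E x x ≡ true → ⊥
  E-irrefl e = E⇒≢ e refl

  E⇒toℕ≢ : ∀ {x y} → E x y ≡ true → toℕ y ≢ toℕ x
  E⇒toℕ≢ e q = E⇒≢ e (Finₚ.toℕ-injective (sym q))

  Pair : Set
  Pair = Fin n × Fin n

  _≟P_ : DecidableEquality Pair
  _≟P_ = _≟F_ ≟× _≟F_

  Pairs : List Pair
  Pairs = cartesianProduct V V

  listing-pairs : Listings.Listing _≟P_ Pairs
  listing-pairs = listing-cartesian _≟F_ _≟F_ (listing-allFin n) (listing-allFin n)

  Triple : Set
  Triple = Fin n × Pair

  _≟T_ : DecidableEquality Triple
  _≟T_ = _≟F_ ≟× _≟P_

  Triples : List Triple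
  Triples = cartesianProduct V Pairs

  listing-triples : Listings.Listing _≟T_ Triples
  listing-triples = listing-cartesian _≟F_ _≟P_ (listing-allFin n) listing-pairs

  Triple-predicate : Set
  Triple-predicate = Fin n → Fin n → Fin n → Bool

  at-triple : Triple-predicate → Triple → Bool
  at-triple g (b , (a , c)) = g b a c

  ∑³ : (Fin n → Fin n → Fin n → ℕ) → ℕ
  ∑³ w = ∑ V (λ b → ∑ V (λ a → ∑ V (λ c → w b a c)))

  #³ : Triple-predicate → ℕ
  #³ g = ∑³ (λ b a c → 𝟙 (g b a c))

  nested≡#³ : ∀ g → sum (map (λ b → sum (map (λ a → count (g b a) V) V)) V) ≡ #³ g
  nested≡#³ g = trans (sum-map≡∑ _ V) (∑-cong V (λ b →
                  trans (sum-map≡∑ _ V) (∑-cong V (λ a → count≡∑ (g b a) V))))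

  ∑³-cong : ∀ {v w} → (∀ b a c → v b a c ≡ w b a c) → ∑³ v ≡ ∑³ w
  ∑³-cong e = ∑-cong V (λ b → ∑-cong V (λ a → ∑-cong V (e b a)))

  ∑³-+ : ∀ v w → ∑³ (λ b a c → v b a c + w b a c) ≡ ∑³ v + ∑³ w
  ∑³-+ v w = trans (∑-cong V (λ b → trans (∑-cong V (λ a → ∑-+ (v b a) (w b a) V)) (∑-+ _ _ V))) (∑-+ _ _ V)

  #³≡∑Triples : ∀ g → #³ g ≡ ∑ Triples (𝟙 ∘ at-triple g)
  #³≡∑Triples g = sym (trans (∑-cartesian _ V Pairs) (∑-cong V (λ b → ∑-cartesian _ V V)))

  #³-swap₁₂ : ∀ g → #³ (λ x y z → g y x z) ≡ #³ g
  #³-swap₁₂ g = ∑-swap (λ x y → ∑ V (λ z → 𝟙 (g y x z))) V V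

  #³-swap₂₃ : ∀ g → #³ (λ x y z → g x z y) ≡ #³ g
  #³-swap₂₃ g = ∑-cong V (λ x → ∑-swap (λ y z → 𝟙 (g x z y)) V V)

  Cherry Cherry-same-part Cherry-triangle Cherry-open : Triple-predicate
  Cherry          b a c = (a <ꟳ c) ∧ E a b ∧ E b c
  Cherry-same-part b a c = (a <ꟳ c) ∧ E a b ∧ E b c ∧ (part a =ꟳ part c)
  Cherry-triangle b a c = (a <ꟳ c) ∧ E a b ∧ E b c ∧ not (part a =ꟳ part c) ∧ E a c
  Cherry-open     b a c = (a <ꟳ c) ∧ E a b ∧ E b c ∧ not (part a =ꟳ part c) ∧ not (E a c)

  -- Σ (dᵢ choose 2) counts cherries: a vertex b of degree d is the centre
  -- of (d choose 2) cherries, and vertices outside ⟨E⟩ have degree 0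
  sumDegC2≡#cherries : sumDegC2 E ≡ #³ Cherry
  sumDegC2≡#cherries = begin
    sumDegC2 E                           ≡⟨ sum-map≡∑ _ (verticesE E) ⟩
    ∑ (verticesE E) (λ x → deg E x C 2)  ≡⟨ ∑-select _ _ V (λ x isolated → cong (_C 2) (no-edges (E x) V isolated)) ⟩
    ∑ V (λ x → deg E x C 2)              ≡⟨ ∑-cong V (λ b → trans (cong (_C 2) (count≡∑ (E b) V)) (choose2-pairs n (E b))) ⟩
    #³ (λ b a c → (a <ꟳ c) ∧ E b a ∧ E b c) ≡⟨ ∑³-cong (λ b a c → cong (λ e → 𝟙 ((a <ꟳ c) ∧ e ∧ E b c)) (E-sym b a)) ⟩
    #³ Cherry                            ∎
    where
    open ≡-Reasoning
    no-edges : ∀ {A : Set} (p : A → Bool) L → any p L ≡ false → count p L ≡ 0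
    no-edges p []      e = refl
    no-edges p (x ∷ L) e with p x
    ... | true  with () ← e
    ... | false = no-edges p L e

  -- a cherry closes to a part-internal pair, a triangle, or a Ξ₂-subgraph
  three-way : ∀ p q r s e → 𝟙 (p ∧ q ∧ r) ≡ 𝟙 (p ∧ q ∧ r ∧ s) + (𝟙 (p ∧ q ∧ r ∧ not s ∧ e) + 𝟙 (p ∧ q ∧ r ∧ not s ∧ not e))
  three-way false q     r     s     e     = refl
  three-way true  false r     s     e     = refl
  three-way true  true  false s     e     = refl
  three-way true  true  true  true  e     = refl
  three-way true  true  true  false true  = refl
  three-way true  true  true  false false = refl

  cherries-split : #³ Cherry ≡ #³ Cherry-same-part + (#³ Cherry-triangle + #³ Cherry-open)
  cherries-split = begin
    #³ Cherry
      ≡⟨ ∑³-cong (λ b a c → three-way (a <ꟳ c) (E a b) (E b c) (part a =ꟳ part c) (E a c)) ⟩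
    ∑³ (λ b a c → 𝟙 (Cherry-same-part b a c) + (𝟙 (Cherry-triangle b a c) + 𝟙 (Cherry-open b a c)))
      ≡⟨ ∑³-+ _ _ ⟩
    #³ Cherry-same-part + ∑³ (λ b a c → 𝟙 (Cherry-triangle b a c) + 𝟙 (Cherry-open b a c))
      ≡⟨ cong (#³ Cherry-same-part +_) (∑³-+ _ _) ⟩
    #³ Cherry-same-part + (#³ Cherry-triangle + #³ Cherry-open) ∎
    where open ≡-Reasoning

  ξ₂≡#open : ξ₂ part E ≡ #³ Cherry-open
  ξ₂≡#open = nested≡#³ Cherry-open

  -- Triangles.  Each triangle {x < y < z} of ⟨E⟩ is the closure of exactly
  -- three cherries, one for each choice of the centre.
  Triangle Ordered-triangle : Triple-predicate
  Triangle         x y z = E x y ∧ E y z ∧ E x z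
  Ordered-triangle x y z = (x <ꟳ y) ∧ (y <ꟳ z) ∧ E x y ∧ E y z ∧ E x z

  ξ₃≡#ordered : ξ₃ E ≡ #³ Ordered-triangle
  ξ₃≡#ordered = nested≡#³ Ordered-triangle

  Triangle-swap₁₂ : ∀ x y z → Triangle y x z ≡ Triangle x y z
  Triangle-swap₁₂ x y z rewrite E-sym y x = cong (E x y ∧_) (Boolₚ.∧-comm (E x z) (E y z))

  Triangle-swap₂₃ : ∀ x y z → Triangle x z y ≡ Triangle x y z
  Triangle-swap₂₃ x y z rewrite E-sym z y = begin
    E x z ∧ E y z ∧ E x y      ≡⟨ Boolₚ.∧-assoc (E x z) (E y z) (E x y) ⟨
    (E x z ∧ E y z) ∧ E x y    ≡⟨ Boolₚ.∧-comm (E x z ∧ E y z) (E x y) ⟩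
    E x y ∧ E x z ∧ E y z      ≡⟨ cong (E x y ∧_) (Boolₚ.∧-comm (E x z) (E y z)) ⟩
    E x y ∧ E y z ∧ E x z      ∎
    where open ≡-Reasoning

  -- a cherry whose leaves are adjacent is a triangle (adjacent leaves lie in different parts)
  Cherry-triangle≡ : ∀ b a c → Cherry-triangle b a c ≡ (a <ꟳ c) ∧ Triangle a b c
  Cherry-triangle≡ b a c = cong (λ x → (a <ꟳ c) ∧ E a b ∧ E b c ∧ x) closing
    where
    closing : not (part a =ꟳ part c) ∧ E a c ≡ E a c
    closing with E a c in eac
    ... | true  = cong (λ x → not x ∧ true) (=ꟳ-false (E-across a c eac))
    ... | false = Boolₚ.∧-zeroʳ _

  Ordered-triangle-factor : ∀ x y z → 𝟙 (Ordered-triangle x y z) ≡ 𝟙 ((x <ꟳ y) ∧ (y <ꟳ z)) * 𝟙 (Triangle x y z)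
  Ordered-triangle-factor x y z = begin
    𝟙 (Ordered-triangle x y z)                              ≡⟨ 𝟙-∧ (x <ꟳ y) _ ⟩
    𝟙 (x <ꟳ y) * 𝟙 ((y <ꟳ z) ∧ Triangle x y z)             ≡⟨ cong (𝟙 (x <ꟳ y) *_) (𝟙-∧ (y <ꟳ z) _) ⟩
    𝟙 (x <ꟳ y) * (𝟙 (y <ꟳ z) * 𝟙 (Triangle x y z))        ≡⟨ *-assoc (𝟙 (x <ꟳ y)) _ _ ⟨
    𝟙 (x <ꟳ y) * 𝟙 (y <ꟳ z) * 𝟙 (Triangle x y z)          ≡⟨ cong (_* 𝟙 (Triangle x y z)) (𝟙-∧ (x <ꟳ y) _) ⟨
    𝟙 ((x <ꟳ y) ∧ (y <ꟳ z)) * 𝟙 (Triangle x y z)          ∎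
    where open ≡-Reasoning

  -- the three centres of a triangle: b before, between, or after the leaves a < c
  triangle-centres : ∀ b a c → 𝟙 (Cherry-triangle b a c)
    ≡ 𝟙 (Ordered-triangle b a c) + 𝟙 (Ordered-triangle a b c) + 𝟙 (Ordered-triangle a c b)
  triangle-centres b a c = begin
    𝟙 (Cherry-triangle b a c)                        ≡⟨ cong 𝟙 (Cherry-triangle≡ b a c) ⟩
    𝟙 ((a <ꟳ c) ∧ Triangle a b c)                   ≡⟨ 𝟙-∧ (a <ꟳ c) _ ⟩
    𝟙 (a <ꟳ c) * tri                                 ≡⟨ split-centre ⟩
    (𝟙 o₁ + 𝟙 o₂ + 𝟙 o₃) * tri                       ≡⟨ trans (*-distribʳ-+ tri (𝟙 o₁ + 𝟙 o₂) (𝟙 o₃))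
                                                              (cong (_+ 𝟙 o₃ * tri) (*-distribʳ-+ tri (𝟙 o₁) (𝟙 o₂))) ⟩
    𝟙 o₁ * tri + 𝟙 o₂ * tri + 𝟙 o₃ * tri             ≡⟨ cong₂ _+_ (cong₂ _+_
         (trans (cong (λ x → 𝟙 o₁ * 𝟙 x) (sym (Triangle-swap₁₂ a b c))) (sym (Ordered-triangle-factor b a c)))
         (sym (Ordered-triangle-factor a b c)))
         (trans (cong (λ x → 𝟙 o₃ * 𝟙 x) (sym (Triangle-swap₂₃ a b c))) (sym (Ordered-triangle-factor a c b))) ⟩
    𝟙 (Ordered-triangle b a c) + 𝟙 (Ordered-triangle a b c) + 𝟙 (Ordered-triangle a c b) ∎
    where
    open ≡-Reasoning
    tri : ℕ
    tri = 𝟙 (Triangle a b c)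
    o₁ o₂ o₃ : Bool
    o₁ = (b <ꟳ a) ∧ (a <ꟳ c)
    o₂ = (a <ꟳ b) ∧ (b <ꟳ c)
    o₃ = (a <ꟳ c) ∧ (c <ꟳ b)
    split-centre : 𝟙 (a <ꟳ c) * tri ≡ (𝟙 o₁ + 𝟙 o₂ + 𝟙 o₃) * tri
    split-centre with Triangle a b c in is-triangle
    ... | false = trans (*-zeroʳ (𝟙 (a <ꟳ c))) (sym (*-zeroʳ (𝟙 o₁ + 𝟙 o₂ + 𝟙 o₃)))
    ... | true  = cong (_* 1) (order-split (toℕ a) (toℕ b) (toℕ c)
                    (E⇒toℕ≢ (∧-true₁ is-triangle)) (λ q → E⇒toℕ≢ (∧-true₁ (∧-true₂ {E a b} is-triangle)) (sym q)))

  3ξ₃≡#triangle : 3 * ξ₃ E ≡ #³ Cherry-triangle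
  3ξ₃≡#triangle = begin
    3 * ξ₃ E                        ≡⟨ cong (3 *_) ξ₃≡#ordered ⟩
    3 * T₀                          ≡⟨ three-times T₀ ⟩
    T₀ + T₀ + T₀                    ≡⟨ cong₂ _+_ (cong (T₀ +_) (#³-swap₁₂ Ordered-triangle))
                                        (trans (#³-swap₁₂ (λ a b c → Ordered-triangle a c b))
                                               (#³-swap₂₃ Ordered-triangle)) ⟨
    #³ Ordered-triangle + #³ (λ b a c → Ordered-triangle a b c) + #³ (λ b a c → Ordered-triangle a c b)
                                    ≡⟨ cong (_+ #³ (λ b a c → Ordered-triangle a c b)) (∑³-+ _ _) ⟨
    ∑³ (λ b a c → 𝟙 (Ordered-triangle b a c) + 𝟙 (Ordered-triangle a b c))
      + #³ (λ b a c → Ordered-triangle a c b)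
                                    ≡⟨ ∑³-+ _ _ ⟨
    ∑³ (λ b a c → 𝟙 (Ordered-triangle b a c) + 𝟙 (Ordered-triangle a b c) + 𝟙 (Ordered-triangle a c b))
                                    ≡⟨ ∑³-cong triangle-centres ⟨
    #³ Cherry-triangle              ∎
    where
    open ≡-Reasoning
    T₀ : ℕ
    T₀ = #³ Ordered-triangle
    three-times : ∀ x → 3 * x ≡ x + x + x
    three-times x = trans (cong (x +_) (cong (x +_) (+-identityʳ x))) (sym (+-assoc x x x))

  -- Ordered cherries (a ≢ c) inject into ordered pairs
  -- of distinct edges via (b; a, c) ↦ ({a, b}, {b, c}); there are twice
  -- as many ordered cherries as cherries, and 2·(|E| choose 2) such pairs.
  -- an edge, represented by its endpoints in increasing order
  Edge : Pair → Bool
  Edge = Increasing E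

  edgeCount≡#edges : edgeCount E ≡ ∑ Pairs (𝟙 ∘ Edge)
  edgeCount≡#edges = trans (sum-map≡∑ _ V)
    (trans (∑-cong V (λ x → count≡∑ _ V)) (sym (∑-cartesian (𝟙 ∘ Edge) V V)))

  Cherry-mirror Wedge : Triple-predicate
  Cherry-mirror b a c = (c <ꟳ a) ∧ E a b ∧ E b c
  Wedge         b a c = not (a =ꟳ c) ∧ E a b ∧ E b c

  #cherries≡#mirror : #³ Cherry ≡ #³ Cherry-mirror
  #cherries≡#mirror = trans (sym (#³-swap₂₃ Cherry)) (∑³-cong mirror)
    where
    mirror : ∀ b a c → 𝟙 (Cherry b c a) ≡ 𝟙 (Cherry-mirror b a c)
    mirror b a c rewrite E-sym c b | E-sym b a = cong (λ x → 𝟙 ((c <ꟳ a) ∧ x)) (Boolₚ.∧-comm (E b c) (E a b))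

  <ᵇ-or->ᵇ : ∀ x y → 𝟙 (x <ᵇ y) + 𝟙 (y <ᵇ x) ≡ 𝟙 (not (x ≡ᵇ y))
  <ᵇ-or->ᵇ x y with <-cmp x y
  ... | tri< lt _ _ rewrite <ᵇ-true lt | <ᵇ-false (<⇒≤ lt) | ≡ᵇ-false (<⇒≢ lt) = refl
  ... | tri≈ _ refl _ rewrite <ᵇ-false (≤-refl {x}) | ≡ᵇ-refl x = refl
  ... | tri> _ _ gt rewrite <ᵇ-false (<⇒≤ gt) | <ᵇ-true gt | ≡ᵇ-false (≢-sym (<⇒≢ gt)) = refl

  cherry-or-mirror : ∀ b a c → 𝟙 (Cherry b a c) + 𝟙 (Cherry-mirror b a c) ≡ 𝟙 (Wedge b a c)
  cherry-or-mirror b a c = begin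
    𝟙 ((a <ꟳ c) ∧ legs) + 𝟙 ((c <ꟳ a) ∧ legs)    ≡⟨ cong₂ _+_ (𝟙-∧ (a <ꟳ c) legs) (𝟙-∧ (c <ꟳ a) legs) ⟩
    𝟙 (a <ꟳ c) * 𝟙 legs + 𝟙 (c <ꟳ a) * 𝟙 legs    ≡⟨ *-distribʳ-+ (𝟙 legs) (𝟙 (a <ꟳ c)) (𝟙 (c <ꟳ a)) ⟨
    (𝟙 (a <ꟳ c) + 𝟙 (c <ꟳ a)) * 𝟙 legs           ≡⟨ cong (_* 𝟙 legs) (<ᵇ-or->ᵇ (toℕ a) (toℕ c)) ⟩
    𝟙 (not (a =ꟳ c)) * 𝟙 legs                     ≡⟨ 𝟙-∧ (not (a =ꟳ c)) legs ⟨
    𝟙 (Wedge b a c)                               ∎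
    where
    open ≡-Reasoning
    legs : Bool
    legs = E a b ∧ E b c

  Distinct-edges : Pair × Pair → Bool
  Distinct-edges (e , f) = Edge e ∧ Edge f ∧ not (does (e ≟P f))

  wedge-edges : Triple → Pair × Pair
  wedge-edges (b , (a , c)) = (sort a b , sort b c)

  #wedges≤ : ∑ Triples (𝟙 ∘ at-triple Wedge) ≤ ∑ (cartesianProduct Pairs Pairs) (𝟙 ∘ Distinct-edges)
  #wedges≤ = Transfer.count-injection _≟T_ (_≟P_ ≟× _≟P_) listing-triples
               (listing-cartesian _≟P_ _≟P_ listing-pairs listing-pairs)
               (at-triple Wedge) Distinct-edges wedge-edges maps-to injective
    where
    legs : ∀ b a c → Wedge b a c ≡ true → a ≢ c × E a b ≡ true × E b c ≡ true
    legs b a c w = =ꟳ-false⇒≢ (not-true (∧-true₁ w)) , ∧-true₁ (∧-true₂ {not (a =ꟳ c)} w)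
                 , ∧-true₂ (∧-true₂ {not (a =ꟳ c)} w)
    maps-to : ∀ t → at-triple Wedge t ≡ true → Distinct-edges (wedge-edges t) ≡ true
    maps-to (b , (a , c)) w with legs b a c w
    ... | a≢c , ab , bc rewrite sort-increasing E E-sym⇒ E-irrefl ab | sort-increasing E E-sym⇒ E-irrefl bc with sort a b ≟P sort b c
    ...   | no _  = refl
    ...   | yes q with sort-≡ q
    ...     | inj₁ (a≡b , _) = ⊥-elim (E⇒≢ ab a≡b)
    ...     | inj₂ (a≡c , _) = ⊥-elim (a≢c a≡c)
    injective : ∀ t t' → at-triple Wedge t ≡ true → at-triple Wedge t' ≡ true → wedge-edges t ≡ wedge-edges t' → t ≡ t'
    injective (b , (a , c)) (b' , (a' , c')) w w' q with legs b a c w | legs b' a' c' w'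
    ... | a≢c , ab , bc | _ with sort-≡ (cong proj₁ q) | sort-≡ (cong proj₂ q)
    ...   | inj₁ (refl , refl) | inj₁ (_ , refl)  = refl
    ...   | inj₁ (refl , refl) | inj₂ (_ , c≡b)   = ⊥-elim (E⇒≢ bc (sym c≡b))
    ...   | inj₂ (refl , refl) | inj₁ (b≡a , _)   = ⊥-elim (E⇒≢ ab (sym b≡a))
    ...   | inj₂ (refl , refl) | inj₂ (_ , c≡a)   = ⊥-elim (a≢c (sym c≡a))

  sumDegC2≤ : sumDegC2 E ≤ edgeCount E C 2
  sumDegC2≤ = *-cancelˡ-≤ 2 (begin
    2 * sumDegC2 E                         ≡⟨ cong (2 *_) sumDegC2≡#cherries ⟩
    2 * #³ Cherry                          ≡⟨ cong (#³ Cherry +_) (trans (+-identityʳ _) #cherries≡#mirror) ⟩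
    #³ Cherry + #³ Cherry-mirror           ≡⟨ trans (sym (∑³-+ _ _)) (∑³-cong cherry-or-mirror) ⟩
    #³ Wedge                               ≡⟨ #³≡∑Triples Wedge ⟩
    ∑ Triples (𝟙 ∘ at-triple Wedge)
                                           ≤⟨ #wedges≤ ⟩
    ∑ (cartesianProduct Pairs Pairs) (𝟙 ∘ Distinct-edges)
                                           ≡⟨ distinct-pairs _≟P_ listing-pairs Edge ⟩
    2 * (∑ Pairs (𝟙 ∘ Edge) C 2)           ≡⟨ cong (λ m → 2 * (m C 2)) edgeCount≡#edges ⟨
    2 * (edgeCount E C 2)                  ∎)
    where open ≤-Reasoning

module _ {n : ℕ} where

  all-intro : ∀ {p : Fin n → Bool} → (∀ x → p x ≡ true) → all p (allFin n) ≡ true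
  all-intro {p} h = T⇒≡true (all⁻ p {xs = allFin n} (All.tabulate (λ {x} _ → ≡true⇒T (h x))))

  all-elim : ∀ {p : Fin n → Bool} → all p (allFin n) ≡ true → ∀ x → p x ≡ true
  all-elim {p} e x = T⇒≡true (All.lookup (all⁺ p (allFin n) (≡true⇒T e)) (∈-allFin x))

  all-false : ∀ {p : Fin n → Bool} x → p x ≡ false → all p (allFin n) ≡ false
  all-false {p} x px with all p (allFin n) in e
  ... | false = refl
  ... | true with () ← trans (sym (all-elim e x)) px

  any-intro : ∀ {p : Fin n → Bool} x → p x ≡ true → any p (allFin n) ≡ true
  any-intro {p} x px = T⇒≡true (any⁺ p (Any.map (λ { refl → ≡true⇒T px }) (∈-allFin x)))

  any-elim : ∀ {p : Fin n → Bool} → any p (allFin n) ≡ true → Σ (Fin n) λ x → p x ≡ true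
  any-elim {p} e with Any.satisfied (any⁻ p (allFin n) (≡true⇒T e))
  ... | x , px = x , T⇒≡true px


all-false⇒ : ∀ {A : Set} {p : A → Bool} L → all p L ≡ false → Σ A λ x → p x ≡ false
all-false⇒ {p = p} (x ∷ L) e with p x in px
... | false = x , px
... | true  = all-false⇒ L e

module Labels {n : ℕ} (h : Labelling n) where

  ℓ : Fin n → Maybe (Fin n × Fin n)
  ℓ = lookup h

  inSub⇒ : ∀ s x → inSub h s x ≡ true → Σ (Fin n) λ m → ℓ x ≡ just (s , m)
  inSub⇒ s x e with ℓ x
  ... | just (s' , m) = m , cong (λ z → just (z , m)) (=ꟳ⇒≡ e)

  inSub-intro : ∀ {s x m} → ℓ x ≡ just (s , m) → inSub h s x ≡ true
  inSub-intro {s} ℓx rewrite ℓx = =ꟳ-refl s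

  edgeOf⇒ : ∀ x y → edgeOf h x y ≡ true →
    Σ (Fin n) λ s → Σ (Fin n) λ m → Σ (Fin n) λ m' → ℓ x ≡ just (s , m) × ℓ y ≡ just (s , m') × m ≢ m'
  edgeOf⇒ x y e with ℓ x | ℓ y
  ... | just (s , m) | just (s' , m') =
    s , m , m' , refl , cong (λ z → just (z , m')) (sym (=ꟳ⇒≡ (∧-true₁ e))) ,
    =ꟳ-false⇒≢ (not-true (∧-true₂ {s =ꟳ s'} e))

  edgeOf-intro : ∀ {x y s m m'} → ℓ x ≡ just (s , m) → ℓ y ≡ just (s , m') → m ≢ m' → edgeOf h x y ≡ true
  edgeOf-intro {s = s} ℓx ℓy m≢m' rewrite ℓx | ℓy | =ꟳ-false m≢m' = ∧-intro (=ꟳ-refl s) refl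

  edgeOf-false⇒same-class : ∀ {x y s m m'} → ℓ x ≡ just (s , m) → ℓ y ≡ just (s , m') → edgeOf h x y ≡ false → m ≡ m'
  edgeOf-false⇒same-class {s = s} {m} {m'} ℓx ℓy e rewrite ℓx | ℓy | =ꟳ-refl s with m =ꟳ m' in q
  ... | true = =ꟳ⇒≡ q

  edgeOf-sym : ∀ {x y} → edgeOf h x y ≡ true → edgeOf h y x ≡ true
  edgeOf-sym {x} {y} e with edgeOf⇒ x y e
  ... | _ , _ , _ , ℓx , ℓy , m≢m' = edgeOf-intro ℓy ℓx (≢-sym m≢m')

  edgeOf-irrefl : ∀ {x} → edgeOf h x x ≡ true → ⊥
  edgeOf-irrefl {x} e with edgeOf⇒ x x e
  ... | _ , _ , _ , ℓx , ℓx' , m≢m' = m≢m' (cong proj₂ (Maybeₚ.just-injective (trans (sym ℓx) ℓx')))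

  =ᴸ⇒≡ : ∀ {u v : Maybe (Fin n × Fin n)} → (u =ᴸ v) ≡ true → u ≡ v
  =ᴸ⇒≡ {nothing}      {nothing}        _ = refl
  =ᴸ⇒≡ {just (s , m)} {just (s' , m')} e
    rewrite =ꟳ⇒≡ {a = s} {s'} (∧-true₁ e) | =ꟳ⇒≡ {a = m} {m'} (∧-true₂ {s =ꟳ s'} e) = refl

  =ᴸ-refl : ∀ (u : Maybe (Fin n × Fin n)) → (u =ᴸ u) ≡ true
  =ᴸ-refl nothing        = refl
  =ᴸ-refl (just (s , m)) = ∧-intro (=ꟳ-refl s) (=ꟳ-refl m)

  Canonical-at : Fin n → Fin n → Fin n → Set
  Canonical-at x s m = toℕ s ≤ toℕ x × toℕ m ≤ toℕ x × ℓ m ≡ just (s , m) × Σ (Fin n) (λ m' → ℓ s ≡ just (s , m'))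

  canonical⇒ : canonical h ≡ true → ∀ {x s m} → ℓ x ≡ just (s , m) → Canonical-at x s m
  canonical⇒ c {x} ℓx with ℓ x | all-elim c x
  canonical⇒ c {x} refl | just (s , m) | ok =
    ≤ᵇ⇒≤′ (∧-true₁ ok) , ≤ᵇ⇒≤′ (∧-true₁ (∧-true₂ {s ≤ꟳ x} ok)) ,
    =ᴸ⇒≡ (∧-true₁ (∧-true₂ {m ≤ꟳ x} (∧-true₂ {s ≤ꟳ x} ok))) ,
    inSub⇒ s s (∧-true₂ {lookup h m =ᴸ just (s , m)} (∧-true₂ {m ≤ꟳ x} (∧-true₂ {s ≤ꟳ x} ok)))

  ⇒canonical : (∀ x {s m} → ℓ x ≡ just (s , m) → Canonical-at x s m) → canonical h ≡ true
  ⇒canonical H with canonical h in c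
  ... | true  = refl
  ... | false with all-false⇒ (allFin n) c
  ...   | x , fails with ℓ x in ℓx | fails
  ...     | just (s , m) | fails' with H x ℓx
  ...       | s≤x , m≤x , ℓm , m' , ℓs with () ← trans (sym fails')
                 (∧-intro (≤ᵇ-true s≤x) (∧-intro (≤ᵇ-true m≤x)
                   (∧-intro (trans (cong (_=ᴸ just (s , m)) ℓm) (=ᴸ-refl (just (s , m)))) (inSub-intro ℓs))))

  module _ {t : ℕ} (part : Fin n → Fin t) (E : Fin n → Fin n → Bool) where

    Garland-at : Fin n → Fin n → Set
    Garland-at x m = part x ≡ part m × Σ (Fin n) (λ y → edgeOf h x y ≡ true)
                   × (∀ y → edgeOf h x y ≡ true → E x y ≡ true)

    -- the per-vertex test of isGarland is local to Defs: it is read off the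
    -- shape of isGarland h, and garland-test≡ computes it by cases on the label
    garland-test : Fin n → Bool
    garland-test = test-of {a = canonical h} {b = any (λ x → not (ℓ x =ᴸ nothing)) (allFin n)}
                           (refl {x = isGarland part E h})
      where
      test-of : ∀ {a b} {p : Fin n → Bool} → (a ∧ b ∧ all p (allFin n)) ≡ (a ∧ b ∧ all p (allFin n)) → Fin n → Bool
      test-of {p = p} _ = p

    garland-test-at : Fin n → Maybe (Fin n × Fin n) → Bool
    garland-test-at x nothing        = true
    garland-test-at x (just (s , m)) = (part x =ꟳ part m) ∧ any (edgeOf h x) (allFin n)
                                       ∧ all (λ y → not (edgeOf h x y) ∨ E x y) (allFin n)

    garland-test≡ : ∀ x → garland-test x ≡ garland-test-at x (ℓ x)
    garland-test≡ x with ℓ x in ℓx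
    ... | nothing = refl
    ... | just _  rewrite ℓx = refl

    isGarland⇒ : isGarland part E h ≡ true → ∀ {x s m} → ℓ x ≡ just (s , m) → Garland-at x m
    isGarland⇒ g {x} {s} {m} ℓx = decode (subst (λ v → garland-test-at x v ≡ true) ℓx
      (trans (sym (garland-test≡ x)) (all-elim (∧-true₂ (∧-true₂ {canonical h} g)) x)))
      where
      implies : ∀ {a b} → not a ∨ b ≡ true → a ≡ true → b ≡ true
      implies {true} e refl = e
      decode : garland-test-at x (just (s , m)) ≡ true → Garland-at x m
      decode ok = =ꟳ⇒≡ (∧-true₁ ok) , any-elim (∧-true₁ (∧-true₂ {part x =ꟳ part m} ok)) ,
                  λ y xy → implies (all-elim (∧-true₂ (∧-true₂ {part x =ꟳ part m} ok)) y) xy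

    ⇒isGarland : canonical h ≡ true → Σ (Fin n) (λ x → ℓ x ≢ nothing)
               → (∀ {x s m} → ℓ x ≡ just (s , m) → Garland-at x m) → isGarland part E h ≡ true
    ⇒isGarland c (x₀ , labelled) H = ∧-intro c (∧-intro (any-intro x₀ (is-labelled labelled))
      (all-intro (λ x → trans (garland-test≡ x) (encode x (ℓ x) refl))))
      where
      is-labelled : ℓ x₀ ≢ nothing → not (ℓ x₀ =ᴸ nothing) ≡ true
      is-labelled ne with ℓ x₀
      ... | nothing = ⊥-elim (ne refl)
      ... | just _  = refl
      implied : ∀ {a b} → (a ≡ true → b ≡ true) → not a ∨ b ≡ true
      implied {false} f = refl
      implied {true}  f = f refl
      encode : ∀ x v → ℓ x ≡ v → garland-test-at x v ≡ true
      encode x nothing        _  = refl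
      encode x (just (s , m)) ℓx with H ℓx
      ... | same-part , (y , xy) , in-E =
        ∧-intro (trans (cong (part x =ꟳ_) (sym same-part)) (=ꟳ-refl (part x)))
                (∧-intro (any-intro y xy) (all-intro (λ y' → implied (in-E y'))))

  cardinality≡∑ : cardinality h ≡ ∑ (allFin n) (𝟙 ∘ (λ x → inSub h x x))
  cardinality≡∑ = count≡∑ _ (allFin n)

  aggregate-edge : Fin n × Fin n → Bool
  aggregate-edge = Increasing (edgeOf h)

  aggregateSize≡∑ : aggregateSize h ≡ ∑ (cartesianProduct (allFin n) (allFin n)) (𝟙 ∘ aggregate-edge)
  aggregateSize≡∑ = trans (sum-map≡∑ _ (allFin n))
    (trans (∑-cong (allFin n) (λ x → count≡∑ _ (allFin n))) (sym (∑-cartesian (𝟙 ∘ aggregate-edge) (allFin n) (allFin n))))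

  unlabelled⇒not-destroyed : ∀ {t} (part : Fin n → Fin t) i x → part x ≡ i → ℓ x ≡ nothing → destroys part h i ≡ false
  unlabelled⇒not-destroyed part i x px ℓx = all-false x survives
    where
    survives : (not (part x =ꟳ i) ∨ not (ℓ x =ᴸ nothing)) ≡ false
    survives rewrite px | ℓx | =ꟳ-refl i = refl

module Survivors {n t : ℕ} (part : Fin n → Fin t) (parts-large : ∀ i → 3 ≤ partSize part i) where
  open Listings (_≟F_ {n}) using (_≐_; occurs-once)

  third-vertex : ∀ i a b → Σ (Fin n) λ x → part x ≡ i × x ≢ a × x ≢ b
  third-vertex i a b with ∑𝟙-witness other (allFin n) nonzero
    where
    in-i other : Fin n → Bool
    in-i x  = part x =ꟳ i
    other x = in-i x ∧ not (does (x ≟F a)) ∧ not (does (x ≟F b))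
    bound : ∀ x → 𝟙 (in-i x) ≤ ((x ≐ a) + (x ≐ b)) + 𝟙 (other x)
    bound x with x ≟F a | x ≟F b | in-i x
    ... | yes _ | _     | true  = s≤s z≤n
    ... | yes _ | _     | false = z≤n
    ... | no _  | yes _ | true  = s≤s z≤n
    ... | no _  | yes _ | false = z≤n
    ... | no _  | no _  | true  = ≤-refl
    ... | no _  | no _  | false = z≤n
    three≤ : 3 ≤ 2 + ∑ (allFin n) (𝟙 ∘ other)
    three≤ = begin
      3                                                           ≤⟨ parts-large i ⟩
      partSize part i                                             ≡⟨ count≡∑ in-i (allFin n) ⟩
      ∑ (allFin n) (𝟙 ∘ in-i)                                     ≤⟨ ∑-mono (allFin n) bound ⟩
      ∑ (allFin n) (λ x → (x ≐ a) + (x ≐ b) + 𝟙 (other x))       ≡⟨ ∑-+ _ _ (allFin n) ⟩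
      ∑ (allFin n) (λ x → (x ≐ a) + (x ≐ b)) + ∑ (allFin n) (𝟙 ∘ other)
                    ≡⟨ cong (_+ ∑ (allFin n) (𝟙 ∘ other)) (trans (∑-+ _ _ (allFin n))
                         (cong₂ _+_ (occurs-once (listing-allFin n) a) (occurs-once (listing-allFin n) b))) ⟩
      2 + ∑ (allFin n) (𝟙 ∘ other)                                ∎
      where open ≤-Reasoning
    nonzero : ∑ (allFin n) (𝟙 ∘ other) ≢ 0
    nonzero e = 1+n≰n {2} (subst (λ z → 3 ≤ 2 + z) e three≤)
  ... | x , ox = x , =ꟳ⇒≡ (∧-true₁ ox) , not-does (x ≟F a) (∧-true₁ (∧-true₂ {part x =ꟳ i} ox))
               , not-does (x ≟F b) (∧-true₂ {not (does (x ≟F a))} (∧-true₂ {part x =ꟳ i} ox))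

  endpoint-in : ∀ w₁ w₂ i → part w₁ ≢ part w₂ → Σ (Fin n) λ a → ∀ x → part x ≡ i → x ≡ w₁ ⊎ x ≡ w₂ → x ≡ a
  endpoint-in w₁ w₂ i across with part w₁ ≟F i
  ... | yes w₁∈i = w₁ , λ { x px (inj₁ q) → q ; x px (inj₂ refl) → ⊥-elim (across (trans w₁∈i (sym px))) }
  ... | no w₁∉i  = w₂ , λ { x px (inj₁ refl) → ⊥-elim (w₁∉i px) ; x px (inj₂ q) → q }

  destroys-nothing : ∀ (h : Labelling n) w₁ w₂ w₃ w₄ → part w₁ ≢ part w₂ → part w₃ ≢ part w₄ →
    (∀ x {s m} → lookup h x ≡ just (s , m) → (x ≡ w₁ ⊎ x ≡ w₂) ⊎ (x ≡ w₃ ⊎ x ≡ w₄)) →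
    count (destroys part h) (allFin t) ≡ 0
  destroys-nothing h w₁ w₂ w₃ w₄ across₁₂ across₃₄ on-edges =
    trans (count≡∑ _ (allFin t)) (∑-zero (allFin t) survives)
    where
    survives : ∀ i → 𝟙 (destroys part h i) ≡ 0
    survives i with endpoint-in w₁ w₂ i across₁₂ | endpoint-in w₃ w₄ i across₃₄
    ... | a , only-a | b , only-b with third-vertex i a b
    ...   | x , x∈i , x≢a , x≢b = cong 𝟙 (Labels.unlabelled⇒not-destroyed h part i x x∈i unlabelled)
      where
      unlabelled : lookup h x ≡ nothing
      unlabelled with lookup h x in ℓx
      ... | nothing = refl
      ... | just _ with on-edges x ℓx
      ...   | inj₁ q = ⊥-elim (x≢a (only-a x x∈i q))
      ...   | inj₂ q = ⊥-elim (x≢b (only-b x x∈i q))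

module Two-edge-garlands {n t : ℕ} (part : Fin n → Fin t) (E : Fin n → Fin n → Bool)
  (E-sym : ∀ x y → E x y ≡ E y x) (E-across : ∀ x y → E x y ≡ true → part x ≢ part y)
  (parts-large : ∀ i → 3 ≤ partSize part i) where
  open Cherries part E E-sym E-across
  open Survivors part parts-large

  Counted : Labelling n → Bool
  Counted h = isGarland part E h ∧ interesting part h ∧ (aggregateSize h ≡ᵇ 2)

  interesting-intro : ∀ h → count (destroys part h) (allFin t) ≡ 0 → cardinality h ≡ 1 → interesting part h ≡ true
  interesting-intro h none one rewrite none | one = refl

  interesting⇒single : ∀ h → interesting part h ≡ true → count (destroys part h) (allFin t) ≡ 0 → cardinality h ≡ 1
  interesting⇒single h i none = sym (trans (cong suc (sym none))
    (≡ᵇ⇒≡ (suc (count (destroys part h) (allFin t))) (cardinality h) (≡true⇒T i)))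

  -- the smaller of two vertices: the label of the cherry's E-subgraph
  smaller : Fin n → Fin n → Fin n
  smaller a b = if a ≤ꟳ b then a else b

  smaller-cases : ∀ a b → (smaller a b ≡ a × toℕ a ≤ toℕ b) ⊎ (smaller a b ≡ b × toℕ b < toℕ a)
  smaller-cases a b with a ≤ꟳ b in a≤b
  ... | true  = inj₁ (refl , ≤ᵇ⇒≤′ a≤b)
  ... | false = inj₂ (refl , ≰⇒> (λ le → case (trans (sym (≤ᵇ-true le)) a≤b)))
    where
    case : true ≡ false → ⊥
    case ()

  smaller≤ : ∀ a b → toℕ (smaller a b) ≤ toℕ a × toℕ (smaller a b) ≤ toℕ b
  smaller≤ a b with smaller-cases a b
  ... | inj₁ (s≡a , a≤b) rewrite s≡a = ≤-refl , a≤b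
  ... | inj₂ (s≡b , b<a) rewrite s≡b = <⇒≤ b<a , ≤-refl

  cherry-label : Fin n → Fin n → Fin n → Fin n → Maybe (Fin n × Fin n)
  cherry-label b a c x = if does (x ≟F a) ∨ does (x ≟F c) then just (smaller a b , a)
                         else (if does (x ≟F b) then just (smaller a b , b) else nothing)

  Same-part : Triple → Bool
  Same-part = at-triple Cherry-same-part

  cherry-garland : Triple → Labelling n
  cherry-garland (b , (a , c)) = tabulate (cherry-label b a c)

  module _ (b a c : Fin n) where
    label-a : cherry-label b a c a ≡ just (smaller a b , a)
    label-a with a ≟F a
    ... | yes _ = refl
    ... | no ne = ⊥-elim (ne refl)

    label-c : cherry-label b a c c ≡ just (smaller a b , a)
    label-c with c ≟F a | c ≟F c
    ... | yes _ | _     = refl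
    ... | no _  | yes _ = refl
    ... | no _  | no ne = ⊥-elim (ne refl)

    label-b : b ≢ a → b ≢ c → cherry-label b a c b ≡ just (smaller a b , b)
    label-b b≢a b≢c with b ≟F a | b ≟F c | b ≟F b
    ... | yes e | _     | _     = ⊥-elim (b≢a e)
    ... | no _  | yes e | _     = ⊥-elim (b≢c e)
    ... | no _  | no _  | yes _ = refl
    ... | no _  | no _  | no ne = ⊥-elim (ne refl)

    label-other : ∀ x → x ≢ a → x ≢ c → x ≢ b → cherry-label b a c x ≡ nothing
    label-other x x≢a x≢c x≢b with x ≟F a | x ≟F c | x ≟F b
    ... | yes e | _     | _     = ⊥-elim (x≢a e)
    ... | no _  | yes e | _     = ⊥-elim (x≢c e)
    ... | no _  | no _  | yes e = ⊥-elim (x≢b e)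
    ... | no _  | no _  | no _  = refl

    label-inv : ∀ x {s m} → cherry-label b a c x ≡ just (s , m) →
      ((x ≡ a ⊎ x ≡ c) × s ≡ smaller a b × m ≡ a) ⊎ (x ≡ b × s ≡ smaller a b × m ≡ b)
    label-inv x e with x ≟F a | x ≟F c | x ≟F b
    label-inv x refl | yes q | _     | _     = inj₁ (inj₁ q , refl , refl)
    label-inv x refl | no _  | yes q | _     = inj₁ (inj₂ q , refl , refl)
    label-inv x refl | no _  | no _  | yes q = inj₂ (q , refl , refl)

  module Cherry-garland (b a c : Fin n) (a<c : toℕ a < toℕ c) (ab : E a b ≡ true) (bc : E b c ≡ true)
                        (a~c : part a ≡ part c) where
    h : Labelling n
    h = cherry-garland (b , (a , c))
    open Labels h

    a≢b : a ≢ b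
    a≢b = E⇒≢ ab
    b≢c : b ≢ c
    b≢c = E⇒≢ bc
    a≢c : a ≢ c
    a≢c a≡c = <⇒≢ a<c (cong toℕ a≡c)

    s₀ : Fin n
    s₀ = smaller a b

    ℓ≡label : ∀ x → ℓ x ≡ cherry-label b a c x
    ℓ≡label = Vecₚ.lookup∘tabulate (cherry-label b a c)

    ℓa : ℓ a ≡ just (s₀ , a)
    ℓa = trans (ℓ≡label a) (label-a b a c)
    ℓc : ℓ c ≡ just (s₀ , a)
    ℓc = trans (ℓ≡label c) (label-c b a c)
    ℓb : ℓ b ≡ just (s₀ , b)
    ℓb = trans (ℓ≡label b) (label-b b a c (≢-sym a≢b) b≢c)

    ℓ-inv : ∀ x {s m} → ℓ x ≡ just (s , m) → ((x ≡ a ⊎ x ≡ c) × s ≡ s₀ × m ≡ a) ⊎ (x ≡ b × s ≡ s₀ × m ≡ b)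
    ℓ-inv x e = label-inv b a c x (trans (sym (ℓ≡label x)) e)

    ℓs₀ : Σ (Fin n) λ m' → ℓ s₀ ≡ just (s₀ , m')
    ℓs₀ with smaller-cases a b
    ... | inj₁ (s₀≡a , _) = a , subst (λ z → ℓ z ≡ just (z , a)) (sym s₀≡a) (subst (λ z → ℓ a ≡ just (z , a)) s₀≡a ℓa)
    ... | inj₂ (s₀≡b , _) = b , subst (λ z → ℓ z ≡ just (z , b)) (sym s₀≡b) (subst (λ z → ℓ b ≡ just (z , b)) s₀≡b ℓb)

    canonical-h : canonical h ≡ true
    canonical-h = ⇒canonical at
      where
      at : ∀ x {s m} → ℓ x ≡ just (s , m) → Canonical-at x s m
      at x ℓx with ℓ-inv x ℓx
      ... | inj₁ (inj₁ refl , refl , refl) = proj₁ (smaller≤ a b) , ≤-refl , ℓa , ℓs₀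
      ... | inj₁ (inj₂ refl , refl , refl) = ≤-trans (proj₁ (smaller≤ a b)) (<⇒≤ a<c) , <⇒≤ a<c , ℓa , ℓs₀
      ... | inj₂ (refl , refl , refl)      = proj₂ (smaller≤ a b) , ≤-refl , ℓb , ℓs₀

    edges : ∀ {x y} → edgeOf h x y ≡ true → ((x ≡ a ⊎ x ≡ c) × y ≡ b) ⊎ (x ≡ b × (y ≡ a ⊎ y ≡ c))
    edges {x} {y} e with edgeOf⇒ x y e
    ... | _ , _ , _ , ℓx , ℓy , m≢m' with ℓ-inv x ℓx | ℓ-inv y ℓy
    ...   | inj₁ (_ , _ , refl) | inj₁ (_ , _ , refl) = ⊥-elim (m≢m' refl)
    ...   | inj₁ (x∈ac , _ , _) | inj₂ (y≡b , _ , _)  = inj₁ (x∈ac , y≡b)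
    ...   | inj₂ (x≡b , _ , _)  | inj₁ (y∈ac , _ , _) = inj₂ (x≡b , y∈ac)
    ...   | inj₂ (_ , _ , refl) | inj₂ (_ , _ , refl) = ⊥-elim (m≢m' refl)

    edges-in-E : ∀ x y → edgeOf h x y ≡ true → E x y ≡ true
    edges-in-E x y e with edges e
    ... | inj₁ (inj₁ refl , refl) = ab
    ... | inj₁ (inj₂ refl , refl) = E-sym⇒ bc
    ... | inj₂ (refl , inj₁ refl) = E-sym⇒ ab
    ... | inj₂ (refl , inj₂ refl) = bc

    garland : isGarland part E h ≡ true
    garland = ⇒isGarland part E canonical-h (a , λ q → case (trans (sym ℓa) q)) at
      where
      case : just (s₀ , a) ≡ nothing → ⊥
      case ()
      at : ∀ {x s m} → ℓ x ≡ just (s , m) → Garland-at part E x m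
      at {x} ℓx with ℓ-inv x ℓx
      ... | inj₁ (inj₁ refl , refl , refl) = refl , (b , edgeOf-intro ℓa ℓb a≢b) , edges-in-E x
      ... | inj₁ (inj₂ refl , refl , refl) = sym a~c , (b , edgeOf-intro ℓc ℓb a≢b) , edges-in-E x
      ... | inj₂ (refl , refl , refl)      = refl , (a , edgeOf-intro ℓb ℓa (≢-sym a≢b)) , edges-in-E x

    nothing-destroyed : count (destroys part h) (allFin t) ≡ 0
    nothing-destroyed = destroys-nothing h a b b c (E-across a b ab) (E-across b c bc) on-edges
      where
      on-edges : ∀ x {s m} → ℓ x ≡ just (s , m) → (x ≡ a ⊎ x ≡ b) ⊎ (x ≡ b ⊎ x ≡ c)
      on-edges x ℓx with ℓ-inv x ℓx
      ... | inj₁ (inj₁ x≡a , _) = inj₁ (inj₁ x≡a)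
      ... | inj₁ (inj₂ x≡c , _) = inj₂ (inj₂ x≡c)
      ... | inj₂ (x≡b , _)      = inj₁ (inj₂ x≡b)

    single : cardinality h ≡ 1
    single = trans cardinality≡∑ (trans (∑-cong (allFin n) only-s₀) (Listings.occurs-once (listing-allFin n) s₀))
      where
      only-s₀ : ∀ x → 𝟙 (inSub h x x) ≡ 𝟙 (does (x ≟F s₀))
      only-s₀ x with x ≟F s₀
      ... | yes refl rewrite inSub-intro (proj₂ ℓs₀) = refl
      ... | no x≢s₀ with inSub h x x in sub
      ...   | false = refl
      ...   | true with inSub⇒ x x sub
      ...     | _ , ℓx with ℓ-inv x ℓx
      ...       | inj₁ (_ , x≡s₀ , _) = ⊥-elim (x≢s₀ x≡s₀)
      ...       | inj₂ (_ , x≡s₀ , _) = ⊥-elim (x≢s₀ x≡s₀)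

    two-edges : aggregateSize h ≡ 2
    two-edges = trans aggregateSize≡∑ (Listings.∑𝟙≡2⇐ _≟P_ listing-pairs aggregate-edge (sort a b) (sort b c)
      (sort-increasing (edgeOf h) edgeOf-sym edgeOf-irrefl (edgeOf-intro ℓa ℓb a≢b))
      (sort-increasing (edgeOf h) edgeOf-sym edgeOf-irrefl (edgeOf-intro ℓb ℓc (≢-sym a≢b)))
      distinct only)
      where
      distinct : sort a b ≢ sort b c
      distinct q with sort-≡ q
      ... | inj₁ (a≡b , _) = a≢b a≡b
      ... | inj₂ (a≡c , _) = a≢c a≡c
      only : ∀ w → aggregate-edge w ≡ true → w ≡ sort a b ⊎ w ≡ sort b c
      only (x , y) e with edges (∧-true₂ {x <ꟳ y} e)
      ... | inj₁ (inj₁ refl , refl) = inj₁ (sorted≡sort (<ᵇ⇒<′ (∧-true₁ e)) (inj₁ (refl , refl)))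
      ... | inj₁ (inj₂ refl , refl) = inj₂ (sorted≡sort (<ᵇ⇒<′ (∧-true₁ e)) (inj₂ (refl , refl)))
      ... | inj₂ (refl , inj₁ refl) = inj₁ (sorted≡sort (<ᵇ⇒<′ (∧-true₁ e)) (inj₂ (refl , refl)))
      ... | inj₂ (refl , inj₂ refl) = inj₂ (sorted≡sort (<ᵇ⇒<′ (∧-true₁ e)) (inj₁ (refl , refl)))

    counted : Counted h ≡ true
    counted = ∧-intro garland (∧-intro (interesting-intro h nothing-destroyed single)
                                       (T⇒≡true (≡⇒≡ᵇ (aggregateSize h) 2 two-edges)))

  module Decode (h : Labelling n) (counted : Counted h ≡ true) where
    open Labels h

    garland : isGarland part E h ≡ true
    garland = ∧-true₁ counted

    canonical-at : ∀ {x s m} → ℓ x ≡ just (s , m) → Canonical-at x s m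
    canonical-at = canonical⇒ (∧-true₁ garland)

    garland-at : ∀ {x s m} → ℓ x ≡ just (s , m) → Garland-at part E x m
    garland-at = isGarland⇒ part E garland

    Adj : Fin n → Fin n → Set
    Adj x y = edgeOf h x y ≡ true

    in-E : ∀ {x y} → Adj x y → E x y ≡ true
    in-E {x} {y} xy with edgeOf⇒ x y xy
    ... | _ , _ , _ , ℓx , _ , _ = proj₂ (proj₂ (garland-at ℓx)) y xy

    neighbour : ∀ {x s m} → ℓ x ≡ just (s , m) → Σ (Fin n) λ y → Adj x y
    neighbour ℓx = proj₁ (proj₂ (garland-at ℓx))

    -- the two edges of the aggregate, u₁ < u₂ and v₁ < v₂ (kept abstract:
    -- unfolding this witness would evaluate the whole count)
    abstract
      two : Σ (Fin n × Fin n) λ u → Σ (Fin n × Fin n) λ v → aggregate-edge u ≡ true × aggregate-edge v ≡ true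
            × u ≢ v × (∀ w → aggregate-edge w ≡ true → w ≡ u ⊎ w ≡ v)
      two = Listings.∑𝟙≡2⇒ _≟P_ listing-pairs aggregate-edge
              (trans (sym aggregateSize≡∑) (≡ᵇ⇒≡ (aggregateSize h) 2 (≡true⇒T (∧-true₂ (∧-true₂ {isGarland part E h} counted)))))

    u₁ u₂ v₁ v₂ : Fin n
    u₁ = proj₁ (proj₁ two)
    u₂ = proj₂ (proj₁ two)
    v₁ = proj₁ (proj₁ (proj₂ two))
    v₂ = proj₂ (proj₁ (proj₂ two))

    u-edge : Adj u₁ u₂
    u-edge = ∧-true₂ {u₁ <ꟳ u₂} (proj₁ (proj₂ (proj₂ two)))
    v-edge : Adj v₁ v₂
    v-edge = ∧-true₂ {v₁ <ꟳ v₂} (proj₁ (proj₂ (proj₂ (proj₂ two))))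
    u₁<u₂ : toℕ u₁ < toℕ u₂
    u₁<u₂ = <ᵇ⇒<′ (∧-true₁ (proj₁ (proj₂ (proj₂ two))))
    v₁<v₂ : toℕ v₁ < toℕ v₂
    v₁<v₂ = <ᵇ⇒<′ (∧-true₁ (proj₁ (proj₂ (proj₂ (proj₂ two)))))

    u≠v : ¬ Joins u₁ u₂ v₁ v₂
    u≠v (inj₁ (v₁≡u₁ , v₂≡u₂)) = proj₁ (proj₂ (proj₂ (proj₂ (proj₂ two)))) (cong₂ _,_ (sym v₁≡u₁) (sym v₂≡u₂))
    u≠v (inj₂ (v₁≡u₂ , v₂≡u₁)) = <-asym u₁<u₂ (subst₂ (λ p q → toℕ p < toℕ q) v₁≡u₂ v₂≡u₁ v₁<v₂)

    adjacent : ∀ {x y} → Adj x y → Joins u₁ u₂ x y ⊎ Joins v₁ v₂ x y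
    adjacent {x} {y} xy with <-cmp (toℕ x) (toℕ y)
    ... | tri< x<y _ _ with proj₂ (proj₂ (proj₂ (proj₂ (proj₂ two)))) (x , y) (∧-intro (<ᵇ-true x<y) xy)
    ...   | inj₁ refl = inj₁ (inj₁ (refl , refl))
    ...   | inj₂ refl = inj₂ (inj₁ (refl , refl))
    adjacent xy | tri≈ _ q _ rewrite Finₚ.toℕ-injective q = ⊥-elim (edgeOf-irrefl xy)
    adjacent {x} {y} xy | tri> _ _ y<x with proj₂ (proj₂ (proj₂ (proj₂ (proj₂ two)))) (y , x) (∧-intro (<ᵇ-true y<x) (edgeOf-sym xy))
    ...   | inj₁ refl = inj₁ (inj₂ (refl , refl))
    ...   | inj₂ refl = inj₂ (inj₂ (refl , refl))

    joined-adjacent : ∀ {x y} → Joins u₁ u₂ x y ⊎ Joins v₁ v₂ x y → Adj x y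
    joined-adjacent (inj₁ (inj₁ (refl , refl))) = u-edge
    joined-adjacent (inj₁ (inj₂ (refl , refl))) = edgeOf-sym u-edge
    joined-adjacent (inj₂ (inj₁ (refl , refl))) = v-edge
    joined-adjacent (inj₂ (inj₂ (refl , refl))) = edgeOf-sym v-edge

    endpoint : ∀ {p q x y : Fin n} → Joins p q x y → x ≡ p ⊎ x ≡ q
    endpoint (inj₁ (x≡p , _)) = inj₁ x≡p
    endpoint (inj₂ (x≡q , _)) = inj₂ x≡q

    on-edges : ∀ x {s m} → ℓ x ≡ just (s , m) → (x ≡ u₁ ⊎ x ≡ u₂) ⊎ (x ≡ v₁ ⊎ x ≡ v₂)
    on-edges x ℓx = Sum.map endpoint endpoint (adjacent (proj₂ (neighbour ℓx)))

    -- no part is destroyed, so the garland is a single E-subgraph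
    single : cardinality h ≡ 1
    single = interesting⇒single h (∧-true₁ (∧-true₂ {isGarland part E h} counted))
               (destroys-nothing h u₁ u₂ v₁ v₂ (E-across u₁ u₂ (in-E u-edge)) (E-across v₁ v₂ (in-E v-edge)) on-edges)

    one-subgraph : ∀ {x y s s' m m'} → ℓ x ≡ just (s , m) → ℓ y ≡ just (s' , m') → s ≡ s'
    one-subgraph {s = s} {s'} ℓx ℓy with s ≟F s'
    ... | yes s≡s' = s≡s'
    ... | no s≢s' = ⊥-elim (1+n≰n {1} (subst (2 ≤_) (trans (sym cardinality≡∑) single)
            (Listings.∑𝟙≥2 _≟F_ (listing-allFin n) (λ x → inSub h x x) s s' (subgraph-label ℓx) (subgraph-label ℓy) s≢s')))
      where
      subgraph-label : ∀ {x s m} → ℓ x ≡ just (s , m) → inSub h s s ≡ true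
      subgraph-label ℓx = inSub-intro (proj₂ (proj₂ (proj₂ (proj₂ (canonical-at ℓx)))))

    -- the two edges share a vertex: otherwise, v₁ lying in the single
    -- E-subgraph would be adjacent to u₁ or u₂, giving a third edge
    shared : (u₁ ≡ v₁ ⊎ u₁ ≡ v₂) ⊎ (u₂ ≡ v₁ ⊎ u₂ ≡ v₂)
    shared with u₁ ≟F v₁ | u₁ ≟F v₂ | u₂ ≟F v₁ | u₂ ≟F v₂
    ... | yes e | _     | _     | _     = inj₁ (inj₁ e)
    ... | no _  | yes e | _     | _     = inj₁ (inj₂ e)
    ... | no _  | no _  | yes e | _     = inj₂ (inj₁ e)
    ... | no _  | no _  | no _  | yes e = inj₂ (inj₂ e)
    ... | no u₁≢v₁ | no u₁≢v₂ | no u₂≢v₁ | no u₂≢v₂ = ⊥-elim third-edge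
      where
      not-adjacent : ∀ {x} → x ≢ v₂ → Adj v₁ x → ⊥
      not-adjacent x≢v₂ v₁x with adjacent v₁x
      ... | inj₁ (inj₁ (v₁≡u₁ , _)) = u₁≢v₁ (sym v₁≡u₁)
      ... | inj₁ (inj₂ (v₁≡u₂ , _)) = u₂≢v₁ (sym v₁≡u₂)
      ... | inj₂ (inj₁ (_ , x≡v₂))  = x≢v₂ x≡v₂
      ... | inj₂ (inj₂ (v₁≡v₂ , _)) = <⇒≢ v₁<v₂ (cong toℕ v₁≡v₂)
      third-edge : ⊥
      third-edge with edgeOf⇒ u₁ u₂ u-edge | edgeOf⇒ v₁ v₂ v-edge
      ... | s , m₁ , m₂ , ℓu₁ , ℓu₂ , m₁≢m₂ | _ , k₁ , _ , ℓv₁ , _ , _ with one-subgraph ℓv₁ ℓu₁ | k₁ ≟F m₁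
      ...   | refl | no k₁≢m₁ = not-adjacent u₁≢v₂ (edgeOf-intro ℓv₁ ℓu₁ k₁≢m₁)
      ...   | refl | yes refl = not-adjacent u₂≢v₂ (edgeOf-intro ℓv₁ ℓu₂ m₁≢m₂)

    record Path (a b c : Fin n) : Set where
      field
        a≢c    : a ≢ c
        edges⇒ : ∀ {x y} → Adj x y → Joins a b x y ⊎ Joins b c x y
        ⇒edges : ∀ {x y} → Joins a b x y ⊎ Joins b c x y → Adj x y

    path-reverse : ∀ {a b c} → Path a b c → Path c b a
    path-reverse P = record
      { a≢c    = ≢-sym (Path.a≢c P)
      ; edges⇒ = λ xy → reverse (Path.edges⇒ P xy)
      ; ⇒edges = λ j → Path.⇒edges P (reverse j) }
      where
      reverse : ∀ {p q r x y} → Joins p q x y ⊎ Joins q r x y → Joins r q x y ⊎ Joins q p x y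
      reverse (inj₁ j) = inj₂ (Joins-flip j)
      reverse (inj₂ j) = inj₁ (Joins-flip j)

    oriented-path : Σ (Fin n) λ a → Σ (Fin n) λ b → Σ (Fin n) λ c → toℕ a < toℕ c × Path a b c
    oriented-path with as-path u₁ u₂ v₁ v₂ u≠v shared
    ... | a , b , c , a≢c , to , from with <-cmp (toℕ a) (toℕ c)
    ...   | tri< a<c _ _ = a , b , c , a<c , P
      where
      P : Path a b c
      P = record { a≢c = a≢c ; edges⇒ = to ∘ adjacent ; ⇒edges = joined-adjacent ∘ from }
    ...   | tri≈ _ q _   = ⊥-elim (a≢c (Finₚ.toℕ-injective q))
    ...   | tri> _ _ c<a = c , b , a , c<a , path-reverse P
      where
      P : Path a b c
      P = record { a≢c = a≢c ; edges⇒ = to ∘ adjacent ; ⇒edges = joined-adjacent ∘ from }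

    module Reconstruct {a b c : Fin n} (a<c : toℕ a < toℕ c) (P : Path a b c) where
      open Path P

      ab : Adj a b
      ab = ⇒edges (inj₁ (inj₁ (refl , refl)))
      bc : Adj b c
      bc = ⇒edges (inj₂ (inj₁ (refl , refl)))

      a≢b : a ≢ b
      a≢b refl = edgeOf-irrefl ab
      b≢c : b ≢ c
      b≢c refl = edgeOf-irrefl bc

      labelled-vertex : ∀ x {s m} → ℓ x ≡ just (s , m) → x ≡ a ⊎ (x ≡ b ⊎ x ≡ c)
      labelled-vertex x ℓx with edges⇒ (proj₂ (neighbour ℓx))
      ... | inj₁ (inj₁ (x≡a , _)) = inj₁ x≡a
      ... | inj₁ (inj₂ (x≡b , _)) = inj₂ (inj₁ x≡b)
      ... | inj₂ (inj₁ (x≡b , _)) = inj₂ (inj₁ x≡b)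
      ... | inj₂ (inj₂ (x≡c , _)) = inj₂ (inj₂ x≡c)

      ac-not-adjacent : edgeOf h a c ≡ false
      ac-not-adjacent with edgeOf h a c in ac
      ... | false = refl
      ... | true with edges⇒ ac
      ...   | inj₁ (inj₁ (_ , c≡b)) = ⊥-elim (b≢c (sym c≡b))
      ...   | inj₁ (inj₂ (a≡b , _)) = ⊥-elim (a≢b a≡b)
      ...   | inj₂ (inj₁ (a≡b , _)) = ⊥-elim (a≢b a≡b)
      ...   | inj₂ (inj₂ (a≡c , _)) = ⊥-elim (a≢c a≡c)

      label-≡ : ∀ {s m s' m' : Fin n} → (Maybe (Fin n × Fin n) ∋ just (s , m)) ≡ just (s' , m') → s ≡ s' × m ≡ m'
      label-≡ refl = refl , refl

      is-cherry : Σ (Fin n) λ s → ℓ a ≡ just (s , a) × ℓ c ≡ just (s , a) × ℓ b ≡ just (s , b)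
                  × s ≡ smaller a b × part a ≡ part c
      is-cherry with edgeOf⇒ a b ab | edgeOf⇒ b c bc
      ... | s , mₐ , m_b , ℓa , ℓb , mₐ≢m_b | _ , m_b' , m_c , ℓb' , ℓc , m_b≢m_c with label-≡ (trans (sym ℓb) ℓb')
      ...   | refl , refl = s , subst (λ m → ℓ a ≡ just (s , m)) mₐ≡a ℓa
                              , subst (λ m → ℓ c ≡ just (s , m)) (trans (sym mₐ≡m_c) mₐ≡a) ℓc
                              , subst (λ m → ℓ b ≡ just (s , m)) m_b≡b ℓb , s≡smaller , a~c
        where
        mₐ≡m_c : mₐ ≡ m_c
        mₐ≡m_c = edgeOf-false⇒same-class ℓa ℓc ac-not-adjacent
        -- each class representative is a labelled vertex, hence one of a, b, c
        m_b≡b : m_b ≡ b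
        m_b≡b with canonical-at ℓb
        ... | _ , _ , ℓm_b , _ with labelled-vertex m_b ℓm_b
        ...   | inj₁ refl        = ⊥-elim (mₐ≢m_b (proj₂ (label-≡ (trans (sym ℓa) ℓm_b))))
        ...   | inj₂ (inj₁ m≡b)  = m≡b
        ...   | inj₂ (inj₂ refl) = ⊥-elim (m_b≢m_c (sym (proj₂ (label-≡ (trans (sym ℓc) ℓm_b)))))
        mₐ≡a : mₐ ≡ a
        mₐ≡a with canonical-at ℓa
        ... | _ , mₐ≤a , ℓmₐ , _ with labelled-vertex mₐ ℓmₐ
        ...   | inj₁ m≡a         = m≡a
        ...   | inj₂ (inj₁ refl) = ⊥-elim (mₐ≢m_b (sym (proj₂ (label-≡ (trans (sym ℓb) ℓmₐ)))))
        ...   | inj₂ (inj₂ refl) = ⊥-elim (<⇒≱ a<c mₐ≤a)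
        -- the subgraph label is its least vertex, the smaller of a and b
        s≡smaller : s ≡ smaller a b
        s≡smaller with canonical-at ℓa | canonical-at ℓb
        ... | s≤a , _ , _ , (_ , ℓs) | s≤b , _ , _ , _ with labelled-vertex s ℓs | smaller-cases a b
        ...   | inj₁ s≡a         | inj₁ (sm≡a , _)   = trans s≡a (sym sm≡a)
        ...   | inj₁ refl        | inj₂ (_ , b<a)    = ⊥-elim (<⇒≱ b<a s≤b)
        ...   | inj₂ (inj₁ refl) | inj₁ (_ , a≤b)    = ⊥-elim (a≢b (Finₚ.toℕ-injective (≤-antisym a≤b s≤a)))
        ...   | inj₂ (inj₁ s≡b)  | inj₂ (sm≡b , _)   = trans s≡b (sym sm≡b)
        ...   | inj₂ (inj₂ refl) | _                 = ⊥-elim (<⇒≱ a<c s≤a)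
        a~c : part a ≡ part c
        a~c = trans (proj₁ (garland-at ℓa)) (trans (cong part mₐ≡m_c) (sym (proj₁ (garland-at ℓc))))

      same-part : Cherry-same-part b a c ≡ true
      same-part = ∧-intro (<ᵇ-true a<c) (∧-intro (in-E ab) (∧-intro (in-E bc)
                    (trans (cong (part a =ꟳ_) (sym a~c)) (=ꟳ-refl (part a)))))
        where
        a~c : part a ≡ part c
        a~c = proj₂ (proj₂ (proj₂ (proj₂ (proj₂ is-cherry))))

      h≡cherry-garland : h ≡ cherry-garland (b , (a , c))
      h≡cherry-garland = trans (sym (Vecₚ.tabulate∘lookup h)) (Vecₚ.tabulate-cong labels)
        where
        s : Fin n
        s = proj₁ is-cherry
        ℓa : ℓ a ≡ just (s , a)
        ℓa = proj₁ (proj₂ is-cherry)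
        ℓc : ℓ c ≡ just (s , a)
        ℓc = proj₁ (proj₂ (proj₂ is-cherry))
        ℓb : ℓ b ≡ just (s , b)
        ℓb = proj₁ (proj₂ (proj₂ (proj₂ is-cherry)))
        s≡ : s ≡ smaller a b
        s≡ = proj₁ (proj₂ (proj₂ (proj₂ (proj₂ is-cherry))))
        labels : ∀ x → ℓ x ≡ cherry-label b a c x
        labels x = by-cases (x ≟F a) (x ≟F c) (x ≟F b)
          where
          by-cases : Dec (x ≡ a) → Dec (x ≡ c) → Dec (x ≡ b) → ℓ x ≡ cherry-label b a c x
          by-cases (yes refl) _ _ = trans ℓa (trans (cong (λ z → just (z , a)) s≡) (sym (label-a b a c)))
          by-cases (no _) (yes refl) _ = trans ℓc (trans (cong (λ z → just (z , a)) s≡) (sym (label-c b a c)))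
          by-cases (no _) (no _) (yes refl) = trans ℓb (trans (cong (λ z → just (z , b)) s≡)
                                                 (sym (label-b b a c (≢-sym a≢b) b≢c)))
          by-cases (no x≢a) (no x≢c) (no x≢b) with ℓ x in ℓx
          ... | nothing = sym (label-other b a c x x≢a x≢c x≢b)
          ... | just _ with labelled-vertex x ℓx
          ...   | inj₁ x≡a        = ⊥-elim (x≢a x≡a)
          ...   | inj₂ (inj₁ x≡b) = ⊥-elim (x≢b x≡b)
          ...   | inj₂ (inj₂ x≡c) = ⊥-elim (x≢c x≡c)

    decode : Σ Triple λ τ → Same-part τ ≡ true × h ≡ cherry-garland τ
    decode with oriented-path
    ... | a , b , c , a<c , P = (b , (a , c)) , Reconstruct.same-part a<c P , Reconstruct.h≡cherry-garland a<c P

  same-part⇒ : ∀ b a c → Cherry-same-part b a c ≡ true → toℕ a < toℕ c × E a b ≡ true × E b c ≡ true × part a ≡ part c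
  same-part⇒ b a c e = <ᵇ⇒<′ (∧-true₁ e) , ∧-true₁ (∧-true₂ {a <ꟳ c} e) , ∧-true₁ (∧-true₂ {E a b} (∧-true₂ {a <ꟳ c} e))
                     , =ꟳ⇒≡ (∧-true₂ {E b c} (∧-true₂ {E a b} (∧-true₂ {a <ꟳ c} e)))

  -- distinct same-part cherries have distinct garlands: the garland
  -- determines its classes {a, c}, {b}, and a as the label of the first
  cherry-garland-injective : ∀ τ τ' → Same-part τ ≡ true → Same-part τ' ≡ true
                           → cherry-garland τ ≡ cherry-garland τ' → τ ≡ τ'
  cherry-garland-injective (b , (a , c)) (b' , (a' , c')) e e' q
    with same-part⇒ b a c e | same-part⇒ b' a' c' e'
  ... | a<c , ab , bc , a~c | a'<c' , ab' , bc' , a'~c' = same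
    where
    module G  = Cherry-garland b a c a<c ab bc a~c
    module G' = Cherry-garland b' a' c' a'<c' ab' bc' a'~c'
    ℓ≡ : ∀ x → lookup (cherry-garland (b , (a , c))) x ≡ lookup (cherry-garland (b' , (a' , c'))) x
    ℓ≡ x = cong (λ g → lookup g x) q
    same : (b , (a , c)) ≡ (b' , (a' , c'))
    same with G'.ℓ-inv c (trans (sym (ℓ≡ c)) G.ℓc) | G'.ℓ-inv b (trans (sym (ℓ≡ b)) G.ℓb)
    ... | inj₂ (c≡b' , _ , a≡b')            | _ = ⊥-elim (G.a≢c (trans a≡b' (sym c≡b')))
    ... | inj₁ (inj₁ c≡a' , _ , a≡a')       | _ = ⊥-elim (G.a≢c (trans a≡a' (sym c≡a')))
    ... | inj₁ (inj₂ refl , _ , refl) | inj₁ (inj₁ b≡a , _ , _) = ⊥-elim (G.a≢b (sym b≡a))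
    ... | inj₁ (inj₂ refl , _ , refl) | inj₁ (inj₂ b≡c , _ , _) = ⊥-elim (G.b≢c b≡c)
    ... | inj₁ (inj₂ refl , _ , refl) | inj₂ (refl , _ , _)     = refl

  μ₂≡#same-part : μ₂ part E ≡ #³ Cherry-same-part
  μ₂≡#same-part = begin
    μ₂ part E                            ≡⟨ count≡∑ Counted (allLabellings n) ⟩
    ∑ (allLabellings n) (𝟙 ∘ Counted)    ≡⟨ Transfer.count-bijection _≟L_ _≟T_ (listing-labellings n) listing-triples
                                              Counted Same-part cherry-garland
                                              (λ { (b , (a , c)) e → counted-of b a c e })
                                              Decode.decode
                                              cherry-garland-injective ⟩
    ∑ Triples (𝟙 ∘ Same-part)            ≡⟨ #³≡∑Triples Cherry-same-part ⟨
    #³ Cherry-same-part                  ∎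
    where
    open ≡-Reasoning
    counted-of : ∀ b a c → Cherry-same-part b a c ≡ true → Counted (cherry-garland (b , (a , c))) ≡ true
    counted-of b a c e with same-part⇒ b a c e
    ... | a<c , ab , bc , a~c = Cherry-garland.counted b a c a<c ab bc a~c

lemma2 : ∀ {n t} (part : Fin n → Fin t) (E : Fin n → Fin n → Bool)
    → (∀ i → 3 ≤ partSize part i)
    → (∀ x y → E x y ≡ E y x)
    → (∀ x y → E x y ≡ true → part x ≢ part y)
    → (μ₂ part E + ξ₂ part E + 3 * ξ₃ E ≡ sumDegC2 E)
    × (sumDegC2 E ≤ edgeCount E C 2)
lemma2 part E parts-large E-sym E-across = identity , sumDegC2≤
  where
  open Cherries part E E-sym E-across
  open Two-edge-garlands part E E-sym E-across parts-large
  open ≡-Reasoning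
  #same-part #triangle #open : ℕ
  #same-part = #³ Cherry-same-part
  #triangle  = #³ Cherry-triangle
  #open      = #³ Cherry-open
  identity : μ₂ part E + ξ₂ part E + 3 * ξ₃ E ≡ sumDegC2 E
  identity = begin
    μ₂ part E + ξ₂ part E + 3 * ξ₃ E ≡⟨ cong₂ _+_ (cong₂ _+_ μ₂≡#same-part ξ₂≡#open) 3ξ₃≡#triangle ⟩
    #same-part + #open + #triangle   ≡⟨ +-assoc #same-part #open #triangle ⟩
    #same-part + (#open + #triangle) ≡⟨ cong (#same-part +_) (+-comm #open #triangle) ⟩
    #same-part + (#triangle + #open) ≡⟨ cherries-split ⟨
    #³ Cherry                        ≡⟨ sumDegC2≡#cherries ⟨
    sumDegC2 E                       ∎
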